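{- Let $\lambda$ be a partition with $r$ parts, $\rho=(r-1,\dots,0)$, $\Theta\in\{\Gamma,\Delta\}^r$ and $1\le i\le r-1$ with $\Theta_i\ne\Theta_{i+1}$. For every state $\mathfrak s\in\mathfrak S^\Theta_{\lambda+\rho}$, \[ \mathrm{wt}(t_{r-i}\mathfrak s)(\mathbf z)=\mathrm{wt}(\mathfrak s)(s_i\mathbf z), \] where $s_i\mathbf z$ is $\mathbf z=(z_1,\dots,z_r)$ with $z_i$ and $z_{i+1}$ swapped.
   Context: Palette $\mathcal P=\{c_1<\dots<c_m\}$; fix $\kappa\in\mathcal P^r$ and an integer $N\ge\lambda_1+r$. Fused crystal vertices: left/right and top/bottom edges each carry $\varnothing$ or one colour. Configurations (left, top, right, bottom), parameter $z$, unlisted weight $0$. Gamma: $(\varnothing,\varnothing,\varnothing,\varnothing)\mapsto1$; $(c_a,c_b,c_a,c_b)\mapsto0$ if $a<b$, $z$ if $a\ge b$; $(c_a,c_b,c_b,c_a)\mapsto z$ if $a<b$, $0$ if $a>b$; $(\varnothing,c_a,\varnothing,c_a)\mapsto0$; $(c_a,\varnothing,c_a,\varnothing)\mapsto z$; $(c_a,\varnothing,\varnothing,c_a)\mapsto z$; $(\varnothing,c_a,c_a,\varnothing)\mapsto1$. Delta: $(\varnothing,\varnothing,\varnothing,\varnothing)\mapsto z$; $(c_a,c_b,c_a,c_b)\mapsto1$ if $a\le b$, $0$ if $a>b$; $(c_b,c_b,c_a,c_a)\mapsto0$ if $a<b$, $1$ if $a>b$; $(\varnothing,c_a,\varnothing,c_a)\mapsto0$;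 $(c_a,\varnothing,c_a,\varnothing)\mapsto1$; $(\varnothing,\varnothing,c_a,c_a)\mapsto z$; $(c_a,c_a,\varnothing,\varnothing)\mapsto1$. Lattice: rows $1..r$ top to bottom, columns $0..N-1$ right to left; row $t$ vertices of type $\Theta_t$, parameter $z_t$. $\mathfrak S^\Theta_{\lambda+\rho}$: edge labellings with all vertex weights nonzero, top boundary edge of column $\lambda_t+r-t$ carrying $\kappa_t$, other top edges and all bottom edges empty, and in row $t$: if $\Theta_t=\Gamma$ left boundary empty and right boundary occupied, if $\Theta_t=\Delta$ right empty and left occupied. $\mathrm{wt}(\mathfrak s)(\mathbf z)$: product of vertex weights. Gelfand–Tsetlin patterns: arrays $(a_{i,j})_{0\le i\le j\le r-1}$ of nonnegative integers with $a_{i-1,j-1}\ge a_{i,j}\ge a_{i-1,j}$; $\mathrm{GTP}^{\Theta'}_\nu$ ($\Theta'\in\{\Gamma,\Delta\}^{r-1}$): patterns with top row $\nu$ whose row pair $(j-1,j)$ satisfies $a_{j-1,l-1}>a_{j,l}$ for all $l$ if $\Theta'_j=\Gamma$, and $a_{j,l}>a_{j-1,l}$ for all $l$ if $\Theta'_j=\Delta$. $\iota_\Theta:\mathfrak S^\Theta_{\lambda+\rho}\to\mathrm{GTP}^{(\Theta_1,\dots,\Theta_{r-1})}_{\lambda+\rho}$ sends a state to the pattern whose row $j$ lists in decreasing order the column numbers of occupied vertical edges directly below lattice row $j$ (row $0$: top boundary); it is a bijection. The involution $t_{r-i}$ on patterns changes only row $i$, replacing $a_{i,l}$ by $\min(a_{i-1,l-1},a_{i+1,l})+\max(a_{i-1,l},a_{i+1,l+1})-a_{i,l}$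 (nonexistent entries of row $i+1$ omitted); when $\Theta_i\ne\Theta_{i+1}$ it maps $\mathrm{GTP}^{(\Theta_1,\dots,\Theta_{r-1})}_{\lambda+\rho}$ onto $\mathrm{GTP}^{((s_i\Theta)_1,\dots,(s_i\Theta)_{r-1})}_{\lambda+\rho}$. On states, $t_{r-i}:=\iota_{s_i\Theta}^{ -1}\circ t_{r-i}\circ\iota_\Theta:\mathfrak S^\Theta_{\lambda+\rho}\to\mathfrak S^{s_i\Theta}_{\lambda+\rho}$, where $s_i\Theta$ swaps $\Theta_i,\Theta_{i+1}$. -}

module Defs where

open import Level using (Level)
open import Data.Nat using (ℕ; zero; suc; _+_; _∸_; _⊓_; _⊔_; _<?_)
open import Data.Fin as F using (Fin; toℕ; fromℕ; fromℕ<; inject₁)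
open import Data.List using (List; []; _∷_)
open import Data.Maybe using (Maybe; just; nothing)
open import Data.Bool using (Bool; true; false; if_then_else_; _∧_)
open import Relation.Nullary using (does; yes; no; ¬_)
open import Relation.Binary.PropositionalEquality using (_≡_; _≢_)
open import Algebra.Bundles using (CommutativeRing)
open import Data.Fin.Permutation.Components using (transpose)

-- Colours: the palette c_1 < ... < c_m is Fin m (c_{a} ↦ index a-1),
-- with the order of Fin.  An edge label is ∅ (nothing) or a colour.

Label : ℕ → Set
Label m = Maybe (Fin m)

data VType : Set where
  Γ Δ : VType

data W : Set where
  w0 w1 wz : W

private
  _=ᶠ_ : ∀ {m} → Fin m → Fin m → Bool
  a =ᶠ b = does (a F.≟ b)
  _<ᶠ_ : ∀ {m} → Fin m → Fin m → Bool
  a <ᶠ b = does (a F.<? b)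
  _≤ᶠ_ : ∀ {m} → Fin m → Fin m → Bool
  a ≤ᶠ b = does (a F.≤? b)

-- Gamma weights, arguments (left, top, right, bottom)
wΓ : ∀ {m} → Label m → Label m → Label m → Label m → W
wΓ nothing nothing nothing nothing = w1
wΓ (just a) (just b) (just c) (just d) =
  if (a =ᶠ c) ∧ (b =ᶠ d) then (if a <ᶠ b then w0 else wz)
  else if (a =ᶠ d) ∧ (b =ᶠ c) then (if a <ᶠ b then wz else w0)
  else w0
wΓ nothing (just a) nothing (just b) = w0
wΓ (just a) nothing (just c) nothing = if a =ᶠ c then wz else w0
wΓ (just a) nothing nothing (just d) = if a =ᶠ d then wz else w0
wΓ nothing (just b) (just c) nothing = if b =ᶠ c then w1 else w0
wΓ _ _ _ _ = w0

-- Delta weights, arguments (left, top, right, bottom)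
wΔ : ∀ {m} → Label m → Label m → Label m → Label m → W
wΔ nothing nothing nothing nothing = wz
wΔ (just a) (just b) (just c) (just d) =
  if (a =ᶠ c) ∧ (b =ᶠ d) then (if a ≤ᶠ b then w1 else w0)
  -- (c_b, c_b, c_a, c_a): left = top = c_b, right = bottom = c_a
  else if (a =ᶠ b) ∧ (c =ᶠ d) then (if c <ᶠ a then w0 else w1)
  else w0
wΔ nothing (just a) nothing (just b) = w0
wΔ (just a) nothing (just c) nothing = if a =ᶠ c then w1 else w0
wΔ nothing nothing (just c) (just d) = if c =ᶠ d then wz else w0
wΔ (just a) (just b) nothing nothing = if a =ᶠ b then w1 else w0
wΔ _ _ _ _ = w0

vweight : ∀ {m} → VType → Label m → Label m → Label m → Label m → W
vweight Γ = wΓ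
vweight Δ = wΔ

-- Lattice rows t : Fin r (t = 0 is the top row, i.e. row 1 of the paper),
-- columns j : Fin N numbered right to left (column 0 rightmost).
-- hor t k  (k : Fin (suc N)) : horizontal edge of row t; hor t j is the
--   right edge of vertex (t,j) and hor t (suc j) its left edge, so
--   hor t 0 is the right boundary and hor t N the left boundary.
-- ver k j  (k : Fin (suc r)) : vertical edge in column j on horizontal cut k;
--   cut k lies directly below lattice row k (cut 0 = top boundary,
--   cut r = bottom boundary).  Vertex (t,j) has top ver t j, bottom ver (t+1) j.

record Labelling (m r N : ℕ) : Set where
  field
    hor : Fin r → Fin (suc N) → Label m
    ver : Fin (suc r) → Fin N → Label m
open Labelling public

vertexW : ∀ {m r N} → (Fin r → VType) → Labelling m r N → Fin r → Fin N → W
vertexW Θ s t j =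
  vweight (Θ t) (hor s t (F.suc j)) (ver s (inject₁ t) j) (hor s t (inject₁ j)) (ver s (F.suc t) j)

-- column λ_t + r - t (paper, t 1-based) for 0-based t
topCol : ∀ {r} → (Fin r → ℕ) → Fin r → ℕ
topCol {r} λ' t = λ' t + (r ∸ suc (toℕ t))

record IsState {m r N : ℕ} (κ : Fin r → Fin m) (λ' : Fin r → ℕ)
               (Θ : Fin r → VType) (s : Labelling m r N) : Set where
  field
    nonzero   : ∀ t j → vertexW Θ s t j ≢ w0
    topOcc    : ∀ t (j : Fin N) → toℕ j ≡ topCol λ' t → ver s F.zero j ≡ just (κ t)
    topEmpty  : ∀ (j : Fin N) → (∀ t → toℕ j ≢ topCol λ' t) → ver s F.zero j ≡ nothing
    botEmpty  : ∀ (j : Fin N) → ver s (fromℕ r) j ≡ nothing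
    leftΓ     : ∀ t → Θ t ≡ Γ → hor s t (fromℕ N) ≡ nothing
    rightΓ    : ∀ t → Θ t ≡ Γ → hor s t F.zero ≢ nothing
    rightΔ    : ∀ t → Θ t ≡ Δ → hor s t F.zero ≡ nothing
    leftΔ     : ∀ t → Θ t ≡ Δ → hor s t (fromℕ N) ≢ nothing

record State (m r N : ℕ) (κ : Fin r → Fin m) (λ' : Fin r → ℕ)
             (Θ : Fin r → VType) : Set where
  field
    lab     : Labelling m r N
    isState : IsState κ λ' Θ lab
open State public

module _ {c ℓ : Level} (R : CommutativeRing c ℓ) where
  open CommutativeRing R renaming (Carrier to A)

  evW : W → A → A
  evW w0 _ = 0#
  evW w1 _ = 1#
  evW wz z = z

  prodFin : (n : ℕ) → (Fin n → A) → A
  prodFin zero    f = 1#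
  prodFin (suc n) f = f F.zero * prodFin n (λ k → f (F.suc k))

  wt : ∀ {m r N} → (Fin r → VType) → Labelling m r N → (Fin r → A) → A
  wt {r = r} {N} Θ s z = prodFin r (λ t → prodFin N (λ j → evW (vertexW Θ s t j) (z t)))

-- Gelfand–Tsetlin patterns: row k (k = 0 .. r-1) as the list of its
-- entries in order (a_{k,k}, a_{k,k+1}, ..., a_{k,r-1}), decreasing.
-- A pattern is represented by ℕ → List ℕ; only rows k < r are significant
-- (rows ≥ r are to be read as empty / nonexistent).

Pattern : Set
Pattern = ℕ → List ℕ

occList : ∀ {m} (N : ℕ) → (Fin N → Label m) → List ℕ
occList zero    f = []
occList (suc N) f with f (fromℕ N)
... | just _  = N ∷ occList N (λ j → f (inject₁ j))
... | nothing = occList N (λ j → f (inject₁ j))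

ι : ∀ {m r N} → Labelling m r N → Pattern
ι {r = r} {N} s k with k <? suc r
... | yes k<  = occList N (ver s (fromℕ< k<))
... | no _    = []

_≈P_ : Pattern → Pattern → ℕ → Set
(P ≈P Q) r = ∀ (k : Fin r) → P (toℕ k) ≡ Q (toℕ k)

nth : List ℕ → ℕ → Maybe ℕ
nth []       _       = nothing
nth (x ∷ xs) zero    = just x
nth (x ∷ xs) (suc n) = nth xs n

nthD : List ℕ → ℕ → ℕ
nthD xs n with nth xs n
... | just x  = x
... | nothing = 0

minM : ℕ → Maybe ℕ → ℕ
minM a (just b) = a ⊓ b
minM a nothing  = a

maxM : ℕ → Maybe ℕ → ℕ
maxM a (just b) = a ⊔ b
maxM a nothing  = a

-- new row i from rows i-1 (above), i (cur), i+1 (below).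
-- Position p of row i is entry a_{i,i+p}; then
-- a_{i-1,l-1} = above[p], a_{i-1,l} = above[p+1],
-- a_{i+1,l} = below[p-1] (absent if p = 0), a_{i+1,l+1} = below[p].
newRowFrom : ℕ → List ℕ → List ℕ → List ℕ → List ℕ
newRowFrom p above below []       = []
newRowFrom p above below (x ∷ xs) =
  (minM (nthD above p) (prev p) + maxM (nthD above (suc p)) (nth below p) ∸ x)
    ∷ newRowFrom (suc p) above below xs
  where
  prev : ℕ → Maybe ℕ
  prev zero    = nothing
  prev (suc q) = nth below q

-- the involution t_{r-i} on patterns (i = row index being changed, 1 ≤ i ≤ r-1);
-- rows with index ≥ r are nonexistent, hence treated as empty.
tPat : (r i : ℕ) → Pattern → Pattern
tPat r i P k with does (k Data.Nat.≟ i)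
... | true  = newRowFrom 0 (P (i ∸ 1)) (belowRow (suc i <? r)) (P i)
  where
  belowRow : Relation.Nullary.Dec _ → List ℕ
  belowRow (yes _) = P (suc i)
  belowRow (no _)  = []
... | false = P k

-- s_i acting on Θ and on z : swap positions p and q (0-based), i.e. the
-- paper's i and i+1.
swapAt : ∀ {a} {r} {X : Set a} → Fin r → Fin r → (Fin r → X) → (Fin r → X)
swapAt p q f k = f (transpose p q k)

-- The occupied columns of the cuts of a state form a Gelfand–Tsetlin pattern in which row t
-- interlaces row t+1, strictly on the side fixed by Θ t; conversely every pattern of this kind is
-- the occupancy skeleton of a state, since an admissible skeleton can always be coloured row by row.
-- A vertex weighs 1 or z according to its left edge, and conservation of paths makes the exponent
-- of z_t equal to the drop |row t| − |row t+1| of column sums.  The Bender–Knuth toggle of row i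
-- exchanges which of the two interlacings at row i is strict, so it produces the pattern of a state
-- for s_i Θ, and it keeps |row i| + |new row i| = |row i−1| + |row i+1|; hence the exponents of rows
-- i and i+1 trade places, which is the effect of swapping z_i and z_{i+1}.

module Submission where

open import Defs
open import Level using (Level)
open import Data.Nat using (ℕ; zero; suc; _+_; _*_; _∸_; _⊓_; _⊔_; _≤_; _<_; _<?_)
import Data.Nat as ℕ
import Data.Nat.Properties as ℕₚ
open import Data.Nat.ListAction using (sum)
open import Data.Nat.Tactic.RingSolver using (solve)
open import Data.Fin as F using (Fin; zero; suc; toℕ; fromℕ; inject₁)
import Data.Fin.Properties as Fₚ
open import Data.Fin.Relation.Unary.Top using (view; ‵fromℕ; ‵inject₁)
import Data.Vec.Functional as V
import Data.Vec.Functional.Properties as Vₚ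
import Data.Fin.Permutation as Perm
open import Function using (_∘_)
open import Data.Fin.Permutation.Components using (transpose; transpose-inverse)
open import Data.Bool using (Bool; true; false; not; if_then_else_; _∧_)
open import Data.Maybe using (Maybe; just; nothing)
open import Data.List using (List; []; _∷_; head; drop)
open import Data.Product using (Σ; _×_; _,_; proj₁; proj₂)
open import Data.Sum using (inj₁; inj₂)
open import Data.Unit using (⊤; tt)
open import Data.Empty using (⊥; ⊥-elim)
open import Relation.Nullary using (¬_; Dec; yes; no; does)
open import Relation.Nullary.Negation using (contradiction)
open import Relation.Nullary.Decidable using (dec-true; dec-false)
open import Relation.Binary.PropositionalEquality
  using (_≡_; _≢_; _≗_; refl; sym; trans; cong; cong₂; cong-app; subst; subst₂; module ≡-Reasoning)
open import Algebra.Bundles using (CommutativeRing)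
import Algebra.Properties.Monoid.Sum as MonoidSum
import Algebra.Properties.CommutativeMonoid.Sum as CommutativeMonoidSum
import Algebra.Properties.Semiring.Exp as SemiringExp

occupied : ∀ {m} → Label m → Bool
occupied (just _) = true
occupied nothing  = false

occupied≡false⇒≡nothing : ∀ {m} (x : Label m) → occupied x ≡ false → x ≡ nothing
occupied≡false⇒≡nothing nothing _ = refl

occupied≡true⇒≢nothing : ∀ {m} (x : Label m) → occupied x ≡ true → x ≢ nothing
occupied≡true⇒≢nothing (just _) _ ()

≡nothing⇒occupied≡false : ∀ {m} (x : Label m) → x ≡ nothing → occupied x ≡ false
≡nothing⇒occupied≡false _ refl = refl

≢nothing⇒occupied≡true : ∀ {m} (x : Label m) → x ≢ nothing → occupied x ≡ true
≢nothing⇒occupied≡true (just _) _   = refl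
≢nothing⇒occupied≡true nothing  x≢∅ = ⊥-elim (x≢∅ refl)

-- The (left, top, right, bottom) occupancies of the vertices of nonzero weight.
Admissible : VType → Bool → Bool → Bool → Bool → Set
Admissible Γ false false false false = ⊤
Admissible Γ true  true  true  true  = ⊤
Admissible Γ true  false true  false = ⊤
Admissible Γ true  false false true  = ⊤
Admissible Γ false true  true  false = ⊤
Admissible Δ false false false false = ⊤
Admissible Δ true  true  true  true  = ⊤
Admissible Δ true  false true  false = ⊤
Admissible Δ false false true  true  = ⊤
Admissible Δ true  true  false false = ⊤
Admissible _ _     _     _     _     = ⊥

leftWeight : VType → Bool → W
leftWeight Γ true  = wz
leftWeight Γ false = w1
leftWeight Δ true  = w1
leftWeight Δ false = wz

if-nonzero : ∀ {w} b → (if b then w else w0) ≢ w0 → (if b then w else w0) ≡ w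
if-nonzero true  _  = refl
if-nonzero false ≢0 = ⊥-elim (≢0 refl)

crossingΓ-nonzero : ∀ x y s u v t →
  (if x ∧ y then (if s then w0 else wz) else if u ∧ v then (if t then wz else w0) else w0) ≢ w0 →
  (if x ∧ y then (if s then w0 else wz) else if u ∧ v then (if t then wz else w0) else w0) ≡ wz
crossingΓ-nonzero true  true  true  u     v     t     ≢0 = ⊥-elim (≢0 refl)
crossingΓ-nonzero true  true  false u     v     t     ≢0 = refl
crossingΓ-nonzero true  false s     true  true  true  ≢0 = refl
crossingΓ-nonzero false y     s     true  true  true  ≢0 = refl
crossingΓ-nonzero true  false s     true  true  false ≢0 = ⊥-elim (≢0 refl)
crossingΓ-nonzero false y     s     true  true  false ≢0 = ⊥-elim (≢0 refl)
crossingΓ-nonzero true  false s     true  false t     ≢0 = ⊥-elim (≢0 refl)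
crossingΓ-nonzero false y     s     true  false t     ≢0 = ⊥-elim (≢0 refl)
crossingΓ-nonzero true  false s     false v     t     ≢0 = ⊥-elim (≢0 refl)
crossingΓ-nonzero false y     s     false v     t     ≢0 = ⊥-elim (≢0 refl)

crossingΔ-nonzero : ∀ x y s u v t →
  (if x ∧ y then (if s then w1 else w0) else if u ∧ v then (if t then w0 else w1) else w0) ≢ w0 →
  (if x ∧ y then (if s then w1 else w0) else if u ∧ v then (if t then w0 else w1) else w0) ≡ w1
crossingΔ-nonzero true  true  true  u     v     t     ≢0 = refl
crossingΔ-nonzero true  true  false u     v     t     ≢0 = ⊥-elim (≢0 refl)
crossingΔ-nonzero true  false s     true  true  false ≢0 = refl
crossingΔ-nonzero false y     s     true  true  false ≢0 = refl
crossingΔ-nonzero true  false s     true  true  true  ≢0 = ⊥-elim (≢0 refl)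
crossingΔ-nonzero false y     s     true  true  true  ≢0 = ⊥-elim (≢0 refl)
crossingΔ-nonzero true  false s     true  false t     ≢0 = ⊥-elim (≢0 refl)
crossingΔ-nonzero false y     s     true  false t     ≢0 = ⊥-elim (≢0 refl)
crossingΔ-nonzero true  false s     false v     t     ≢0 = ⊥-elim (≢0 refl)
crossingΔ-nonzero false y     s     false v     t     ≢0 = ⊥-elim (≢0 refl)

NonzeroVertex : ∀ {m} → VType → Label m → Label m → Label m → Label m → Set
NonzeroVertex θ l t r b =
  Admissible θ (occupied l) (occupied t) (occupied r) (occupied b) × vweight θ l t r b ≡ leftWeight θ (occupied l)

nonzero-vertex : ∀ {m} θ (l t r b : Label m) → vweight θ l t r b ≢ w0 → NonzeroVertex θ l t r b
nonzero-vertex Γ nothing  nothing  nothing  nothing  ≢0 = tt , refl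
nonzero-vertex Γ nothing  (just b) (just c) nothing  ≢0 = tt , if-nonzero _ ≢0
nonzero-vertex Γ (just a) nothing  nothing  (just d) ≢0 = tt , if-nonzero _ ≢0
nonzero-vertex Γ (just a) nothing  (just c) nothing  ≢0 = tt , if-nonzero _ ≢0
nonzero-vertex Γ (just a) (just b) (just c) (just d) ≢0 =
  tt , crossingΓ-nonzero (does (a F.≟ c)) (does (b F.≟ d)) (does (a F.<? b))
                         (does (a F.≟ d)) (does (b F.≟ c)) (does (a F.<? b)) ≢0
nonzero-vertex Γ nothing  nothing  nothing  (just _) ≢0 = ⊥-elim (≢0 refl)
nonzero-vertex Γ nothing  nothing  (just _) nothing  ≢0 = ⊥-elim (≢0 refl)
nonzero-vertex Γ nothing  nothing  (just _) (just _) ≢0 = ⊥-elim (≢0 refl)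
nonzero-vertex Γ nothing  (just _) nothing  nothing  ≢0 = ⊥-elim (≢0 refl)
nonzero-vertex Γ nothing  (just _) nothing  (just _) ≢0 = ⊥-elim (≢0 refl)
nonzero-vertex Γ nothing  (just _) (just _) (just _) ≢0 = ⊥-elim (≢0 refl)
nonzero-vertex Γ (just _) nothing  nothing  nothing  ≢0 = ⊥-elim (≢0 refl)
nonzero-vertex Γ (just _) nothing  (just _) (just _) ≢0 = ⊥-elim (≢0 refl)
nonzero-vertex Γ (just _) (just _) nothing  nothing  ≢0 = ⊥-elim (≢0 refl)
nonzero-vertex Γ (just _) (just _) nothing  (just _) ≢0 = ⊥-elim (≢0 refl)
nonzero-vertex Γ (just _) (just _) (just _) nothing  ≢0 = ⊥-elim (≢0 refl)
nonzero-vertex Δ nothing  nothing  nothing  nothing  ≢0 = tt , refl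
nonzero-vertex Δ nothing  nothing  (just c) (just d) ≢0 = tt , if-nonzero _ ≢0
nonzero-vertex Δ (just a) nothing  (just c) nothing  ≢0 = tt , if-nonzero _ ≢0
nonzero-vertex Δ (just a) (just b) nothing  nothing  ≢0 = tt , if-nonzero _ ≢0
nonzero-vertex Δ (just a) (just b) (just c) (just d) ≢0 =
  tt , crossingΔ-nonzero (does (a F.≟ c)) (does (b F.≟ d)) (does (a F.≤? b))
                         (does (a F.≟ b)) (does (c F.≟ d)) (does (c F.<? a)) ≢0
nonzero-vertex Δ nothing  nothing  nothing  (just _) ≢0 = ⊥-elim (≢0 refl)
nonzero-vertex Δ nothing  nothing  (just _) nothing  ≢0 = ⊥-elim (≢0 refl)
nonzero-vertex Δ nothing  (just _) nothing  nothing  ≢0 = ⊥-elim (≢0 refl)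
nonzero-vertex Δ nothing  (just _) nothing  (just _) ≢0 = ⊥-elim (≢0 refl)
nonzero-vertex Δ nothing  (just _) (just _) nothing  ≢0 = ⊥-elim (≢0 refl)
nonzero-vertex Δ nothing  (just _) (just _) (just _) ≢0 = ⊥-elim (≢0 refl)
nonzero-vertex Δ (just _) nothing  nothing  nothing  ≢0 = ⊥-elim (≢0 refl)
nonzero-vertex Δ (just _) nothing  nothing  (just _) ≢0 = ⊥-elim (≢0 refl)
nonzero-vertex Δ (just _) nothing  (just _) (just _) ≢0 = ⊥-elim (≢0 refl)
nonzero-vertex Δ (just _) (just _) nothing  (just _) ≢0 = ⊥-elim (≢0 refl)
nonzero-vertex Δ (just _) (just _) (just _) nothing  ≢0 = ⊥-elim (≢0 refl)

-- Colouring a row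

record Completion {m} (weight : Label m → Label m → W) (O₁ O₂ : Bool) : Set where
  constructor completion
  field
    out₁    : Label m
    out₂    : Label m
    occ₁    : occupied out₁ ≡ O₁
    occ₂    : occupied out₂ ≡ O₂
    nonzero : weight out₁ out₂ ≢ w0

≟-refl : ∀ {m} (a : Fin m) → does (a F.≟ a) ≡ true
≟-refl a = dec-true (a F.≟ a) refl

if-true-nonzero : ∀ {w b} → b ≡ true → w ≢ w0 → (if b then w else w0) ≢ w0
if-true-nonzero refl w≢0 = w≢0

w1≢w0 : w1 ≢ w0
w1≢w0 ()

wz≢w0 : wz ≢ w0
wz≢w0 ()

-- In a Γ row colours move rightwards, so left and top labels determine right and bottom.
completeΓ : ∀ {m} (l t : Label m) R B → Admissible Γ (occupied l) (occupied t) R B →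
            Completion (wΓ l t) R B
completeΓ nothing  nothing  false false _ = completion nothing nothing refl refl w1≢w0
completeΓ (just a) nothing  true  false _ = completion (just a) nothing refl refl (if-true-nonzero (≟-refl a) wz≢w0)
completeΓ (just a) nothing  false true  _ = completion nothing (just a) refl refl (if-true-nonzero (≟-refl a) wz≢w0)
completeΓ nothing  (just b) true  false _ = completion (just b) nothing refl refl (if-true-nonzero (≟-refl b) w1≢w0)
completeΓ (just a) (just b) true  true  _ with a F.<? b
... | yes a<b = completion (just b) (just a) refl refl nonzero
  where
  nonzero : wΓ (just a) (just b) (just b) (just a) ≢ w0
  nonzero rewrite dec-false (a F.≟ b) (λ a≡b → Fₚ.<-irrefl a≡b a<b) | ≟-refl a | ≟-refl b
                | dec-true (a F.<? b) a<b = λ ()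
... | no a≮b = completion (just a) (just b) refl refl nonzero
  where
  nonzero : wΓ (just a) (just b) (just a) (just b) ≢ w0
  nonzero rewrite ≟-refl a | ≟-refl b | dec-false (a F.<? b) a≮b = λ ()

-- In a Δ row colours move leftwards, so top and right labels determine left and bottom.
completeΔ : ∀ {m} (t r : Label m) L B → Admissible Δ L (occupied t) (occupied r) B →
            Completion (λ l b → wΔ l t r b) L B
completeΔ nothing  nothing  false false _ = completion nothing nothing refl refl wz≢w0
completeΔ nothing  (just a) true  false _ = completion (just a) nothing refl refl (if-true-nonzero (≟-refl a) w1≢w0)
completeΔ nothing  (just a) false true  _ = completion nothing (just a) refl refl (if-true-nonzero (≟-refl a) wz≢w0)
completeΔ (just b) nothing  true  false _ = completion (just b) nothing refl refl (if-true-nonzero (≟-refl b) w1≢w0)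
completeΔ (just b) (just a) true  true  _ with a F.≤? b
... | yes a≤b = completion (just a) (just b) refl refl nonzero
  where
  nonzero : wΔ (just a) (just b) (just a) (just b) ≢ w0
  nonzero rewrite ≟-refl a | ≟-refl b | dec-true (a F.≤? b) a≤b = λ ()
... | no a≰b = completion (just b) (just a) refl refl nonzero
  where
  nonzero : wΔ (just b) (just b) (just a) (just a) ≢ w0
  nonzero rewrite dec-false (b F.≟ a) (λ b≡a → a≰b (Fₚ.≤-reflexive (sym b≡a))) | ≟-refl a | ≟-refl b
                | dec-false (a F.<? b) (λ a<b → a≰b (ℕₚ.<⇒≤ a<b)) = λ ()

snoc : ∀ {a} {A : Set a} {n} → (Fin n → A) → A → Fin (suc n) → A
snoc {n = zero}  f x zero    = x
snoc {n = suc n} f x zero    = f zero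
snoc {n = suc n} f x (suc i) = snoc (f ∘ suc) x i

snoc-inject₁ : ∀ {a} {A : Set a} {n} (f : Fin n → A) x j → snoc f x (inject₁ j) ≡ f j
snoc-inject₁ f x zero    = refl
snoc-inject₁ f x (suc j) = snoc-inject₁ (f ∘ suc) x j

snoc-fromℕ : ∀ {a} {A : Set a} {n} (f : Fin n → A) x → snoc f x (fromℕ n) ≡ x
snoc-fromℕ {n = zero}  f x = refl
snoc-fromℕ {n = suc n} f x = snoc-fromℕ (f ∘ suc) x

AdmissibleRow : VType → (n : ℕ) → (Fin n → Bool) → (Fin n → Bool) → (Fin (suc n) → Bool) → Set
AdmissibleRow θ n TO BO HO = ∀ j → Admissible θ (HO (suc j)) (TO j) (HO (inject₁ j)) (BO j)

RowNonzero : ∀ {m} → VType → (n : ℕ) → (Fin n → Label m) → (Fin n → Label m) → (Fin (suc n) → Label m) → Set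
RowNonzero θ n T B H = ∀ j → vweight θ (H (suc j)) (T j) (H (inject₁ j)) (B j) ≢ w0

record RowColouring {m} (θ : VType) (n : ℕ) (T : Fin n → Label m)
                    (BO : Fin n → Bool) (HO : Fin (suc n) → Bool) : Set where
  field
    horizontal : Fin (suc n) → Label m
    bottom     : Fin n → Label m
    nonzero    : RowNonzero θ n T bottom horizontal
    horOcc     : ∀ k → occupied (horizontal k) ≡ HO k
    botOcc     : ∀ j → occupied (bottom j) ≡ BO j

colourRowΓ : ∀ {m} n {TO BO HO} → AdmissibleRow Γ n TO BO HO →
             (T : Fin n → Label m) → (∀ j → occupied (T j) ≡ TO j) →
             (l : Label m) → occupied l ≡ HO (fromℕ n) →
             Σ (RowColouring Γ n T BO HO) λ C → RowColouring.horizontal C (fromℕ n) ≡ l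
colourRowΓ zero _ T _ l l-occ = record
  { horizontal = λ _ → l ; bottom = λ () ; nonzero = λ () ; horOcc = λ { zero → l-occ } ; botOcc = λ () } , refl
colourRowΓ (suc n) {TO} {BO} {HO} adm T T-occ l l-occ = record
  { horizontal = snoc C.horizontal l ; bottom = snoc C.bottom c.out₂
  ; nonzero = nonzero ; horOcc = horOcc ; botOcc = botOcc } , snoc-fromℕ C.horizontal l
  where
  c = completeΓ l (T (fromℕ n)) _ _
        (subst₂ (λ L T → Admissible Γ L T _ _) (sym l-occ) (sym (T-occ (fromℕ n))) (adm (fromℕ n)))
  module c = Completion c
  rest = colourRowΓ n (adm ∘ inject₁) (V.init T) (T-occ ∘ inject₁) c.out₁ c.occ₁
  module C = RowColouring (proj₁ rest)

  nonzero : RowNonzero Γ (suc n) T (snoc C.bottom c.out₂) (snoc C.horizontal l)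
  nonzero j with view j
  ... | ‵fromℕ rewrite snoc-fromℕ C.horizontal l | snoc-fromℕ C.bottom c.out₂
                     | snoc-inject₁ C.horizontal l (fromℕ n) | proj₂ rest = c.nonzero
  ... | ‵inject₁ k rewrite snoc-inject₁ C.bottom c.out₂ k | snoc-inject₁ C.horizontal l (suc k)
                         | snoc-inject₁ C.horizontal l (inject₁ k) = C.nonzero k

  horOcc : ∀ k → occupied (snoc C.horizontal l k) ≡ HO k
  horOcc k with view k
  ... | ‵fromℕ     rewrite snoc-fromℕ C.horizontal l = l-occ
  ... | ‵inject₁ k rewrite snoc-inject₁ C.horizontal l k = C.horOcc k

  botOcc : ∀ j → occupied (snoc C.bottom c.out₂ j) ≡ BO j
  botOcc j with view j
  ... | ‵fromℕ     rewrite snoc-fromℕ C.bottom c.out₂ = c.occ₂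
  ... | ‵inject₁ j rewrite snoc-inject₁ C.bottom c.out₂ j = C.botOcc j

colourRowΔ : ∀ {m} n {TO BO HO} → AdmissibleRow Δ n TO BO HO →
             (T : Fin n → Label m) → (∀ j → occupied (T j) ≡ TO j) →
             (r : Label m) → occupied r ≡ HO zero →
             Σ (RowColouring Δ n T BO HO) λ C → RowColouring.horizontal C zero ≡ r
colourRowΔ zero _ T _ r r-occ = record
  { horizontal = λ _ → r ; bottom = λ () ; nonzero = λ () ; horOcc = λ { zero → r-occ } ; botOcc = λ () } , refl
colourRowΔ (suc n) {TO} {BO} {HO} adm T T-occ r r-occ = record
  { horizontal = r V.∷ C.horizontal ; bottom = c.out₂ V.∷ C.bottom
  ; nonzero = nonzero ; horOcc = horOcc ; botOcc = botOcc } , refl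
  where
  c = completeΔ (T zero) r _ _
        (subst₂ (λ T R → Admissible Δ _ T R _) (sym (T-occ zero)) (sym r-occ) (adm zero))
  module c = Completion c
  rest = colourRowΔ n (adm ∘ suc) (V.tail T) (T-occ ∘ suc) c.out₁ c.occ₁
  module C = RowColouring (proj₁ rest)

  nonzero : RowNonzero Δ (suc n) T (c.out₂ V.∷ C.bottom) (r V.∷ C.horizontal)
  nonzero zero    rewrite proj₂ rest = c.nonzero
  nonzero (suc j) = C.nonzero j

  horOcc : ∀ k → occupied ((r V.∷ C.horizontal) k) ≡ HO k
  horOcc zero    = r-occ
  horOcc (suc k) = C.horOcc k

  botOcc : ∀ j → occupied ((c.out₂ V.∷ C.bottom) j) ≡ BO j
  botOcc zero    = c.occ₂
  botOcc (suc j) = C.botOcc j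

-- Cuts and interlacing

prependIf : Bool → ℕ → List ℕ → List ℕ
prependIf true  n U = n ∷ U
prependIf false n U = U

occupiedColumns : (n : ℕ) → (Fin n → Bool) → List ℕ
occupiedColumns zero    f = []
occupiedColumns (suc n) f = prependIf (f (fromℕ n)) n (occupiedColumns n (V.init f))

occList≡occupiedColumns : ∀ {m} n (f : Fin n → Label m) → occList n f ≡ occupiedColumns n (occupied ∘ f)
occList≡occupiedColumns zero    f = refl
occList≡occupiedColumns (suc n) f with f (fromℕ n)
... | just _  = cong (n ∷_) (occList≡occupiedColumns n (V.init f))
... | nothing = occList≡occupiedColumns n (V.init f)

occupiedColumns-cong : ∀ n {f g : Fin n → Bool} → (∀ j → f j ≡ g j) → occupiedColumns n f ≡ occupiedColumns n g
occupiedColumns-cong zero    f≗g = refl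
occupiedColumns-cong (suc n) f≗g =
  cong₂ (λ b U → prependIf b n U) (f≗g (fromℕ n)) (occupiedColumns-cong n (f≗g ∘ inject₁))

occupiedColumns-none : ∀ n → occupiedColumns n (λ _ → false) ≡ []
occupiedColumns-none zero    = refl
occupiedColumns-none (suc n) = occupiedColumns-none n

count : Bool → ℕ
count true  = 1
count false = 0

count-not : ∀ b → count (not b) + count b ≡ 1
count-not true  = refl
count-not false = refl

Dominates : Bool → ℕ → ℕ → Set
Dominates s x y = count s + y ≤ x

DominatesHead : Bool → ℕ → List ℕ → Set
DominatesHead s x []      = ⊤
DominatesHead s x (y ∷ _) = Dominates s x y

-- Interlace a b (x₀ ∷ x₁ ∷ …) (y₀ ∷ y₁ ∷ …) : x₀ ≥ y₀ ≥ x₁ ≥ y₁ ≥ … ≥ xₖ, both lists strictly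
-- decreasing; the steps xᵢ ≥ yᵢ are strict iff b, the steps yᵢ ≥ xᵢ₊₁ strict iff a.
mutual
  Interlace : Bool → Bool → List ℕ → List ℕ → Set
  Interlace a b []      Y = ⊥
  Interlace a b (x ∷ X) Y = DominatesHead b x Y × DominatesHead true x X × Interlace₌ a b X Y

  Interlace₌ : Bool → Bool → List ℕ → List ℕ → Set
  Interlace₌ a b X []      = X ≡ []
  Interlace₌ a b X (y ∷ Y) = DominatesHead a y X × DominatesHead true y Y × Interlace a b X Y

strictUpRight strictUpLeft leftBoundary : VType → Bool
strictUpRight Γ = false
strictUpRight Δ = true
strictUpLeft  Γ = true
strictUpLeft  Δ = false
leftBoundary  Γ = false
leftBoundary  Δ = true

InterlaceOf : VType → List ℕ → List ℕ → Set
InterlaceOf θ = Interlace (strictUpRight θ) (strictUpLeft θ)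

-- The interlacing of the columns right of a cut, given the occupancy L of the horizontal edge at
-- the cut; it is complete (top one longer) exactly when L is the left-boundary value.
RowInterlace : VType → Bool → List ℕ → List ℕ → Set
RowInterlace Γ false = Interlace  false true
RowInterlace Γ true  = Interlace₌ false true
RowInterlace Δ true  = Interlace  true  false
RowInterlace Δ false = Interlace₌ true  false

RowInterlace-leftBoundary : ∀ θ {U V} → RowInterlace θ (leftBoundary θ) U V → InterlaceOf θ U V
RowInterlace-leftBoundary Γ I = I
RowInterlace-leftBoundary Δ I = I

InterlaceOf⇒RowInterlace : ∀ θ {U V} → InterlaceOf θ U V → RowInterlace θ (leftBoundary θ) U V
InterlaceOf⇒RowInterlace Γ I = I
InterlaceOf⇒RowInterlace Δ I = I

RowInterlace-[] : ∀ θ L → RowInterlace θ L [] [] → L ≡ not (leftBoundary θ)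
RowInterlace-[] Γ true  _ = refl
RowInterlace-[] Δ false _ = refl

DominatesHead-strict⇒weak : ∀ n U → DominatesHead true n U → DominatesHead false n U
DominatesHead-strict⇒weak n []      _   = tt
DominatesHead-strict⇒weak n (x ∷ U) x<n = ℕₚ.<⇒≤ x<n

DominatesHead-suc : ∀ n U → DominatesHead true n U → DominatesHead true (suc n) U
DominatesHead-suc n []      _   = tt
DominatesHead-suc n (x ∷ U) x<n = ℕₚ.m<n⇒m<1+n x<n

dominates⇒≤ : ∀ s {x y} → Dominates s x y → y ≤ x
dominates⇒≤ s y≺x = ℕₚ.≤-trans (ℕₚ.m≤n+m _ (count s)) y≺x

dominates-≤ˡ : ∀ s {x w y} → Dominates s x y → x ≤ w → Dominates s w y
dominates-≤ˡ s = ℕₚ.≤-trans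

dominates-≤ʳ : ∀ s {x y u} → Dominates s x y → u ≤ y → Dominates s x u
dominates-≤ʳ s y≺x u≤y = ℕₚ.≤-trans (ℕₚ.+-monoʳ-≤ (count s) u≤y) y≺x

dominates-⊔ : ∀ s {x y u} → Dominates s x y → Dominates s x u → Dominates s x (y ⊔ u)
dominates-⊔ s {x} {y} {u} y≺x u≺x =
  subst (_≤ x) (sym (ℕₚ.+-distribˡ-⊔ (count s) y u)) (ℕₚ.⊔-lub y≺x u≺x)

dominates-⊓ : ∀ s {x w y} → Dominates s x y → Dominates s w y → Dominates s (x ⊓ w) y
dominates-⊓ s = ℕₚ.⊓-glb

dominates-chain : ∀ s {x y u} → Dominates s x y → Dominates (not s) y u → u < x
dominates-chain s {x} {y} {u} y≺x u≺y = ℕₚ.≤-trans (begin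
  suc u                           ≡⟨ cong (_+ u) (sym (trans (ℕₚ.+-comm (count s) _) (count-not s))) ⟩
  count s + count (not s) + u     ≡⟨ ℕₚ.+-assoc (count s) _ u ⟩
  count s + (count (not s) + u)   ≤⟨ ℕₚ.+-monoʳ-≤ (count s) u≺y ⟩
  count s + y                     ∎) y≺x
  where open ℕₚ.≤-Reasoning

balance-dominatesˡ : ∀ s {t y m M} → t + y ≡ m + M → Dominates s m y → Dominates s t M
balance-dominatesˡ s {t} {y} {m} {M} e y≺m = ℕₚ.+-cancelʳ-≤ y _ t (begin
  count s + M + y     ≡⟨ trans (cong (_+ y) (ℕₚ.+-comm (count s) M)) (ℕₚ.+-assoc M (count s) y) ⟩
  M + (count s + y)   ≤⟨ ℕₚ.+-monoʳ-≤ M y≺m ⟩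
  M + m               ≡⟨ ℕₚ.+-comm M m ⟩
  m + M               ≡⟨ sym e ⟩
  t + y               ∎)
  where open ℕₚ.≤-Reasoning

balance-dominatesʳ : ∀ s {t y m M} → t + y ≡ m + M → Dominates s y M → Dominates s m t
balance-dominatesʳ s {t} {y} {m} {M} e M≺y = ℕₚ.+-cancelʳ-≤ M _ m (begin
  count s + t + M     ≡⟨ trans (cong (_+ M) (ℕₚ.+-comm (count s) t)) (ℕₚ.+-assoc t (count s) M) ⟩
  t + (count s + M)   ≤⟨ ℕₚ.+-monoʳ-≤ t M≺y ⟩
  t + y               ≡⟨ e ⟩
  m + M               ∎)
  where open ℕₚ.≤-Reasoning

occupiedColumns-bounded : ∀ n f → DominatesHead true n (occupiedColumns n f)
occupiedColumns-bounded zero    f = tt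
occupiedColumns-bounded (suc n) f with f (fromℕ n)
... | true  = ℕₚ.≤-refl
... | false = DominatesHead-suc n (occupiedColumns n (V.init f)) (occupiedColumns-bounded n (V.init f))

interlace-extend : ∀ θ (L T R B : Bool) n U V → Admissible θ L T R B →
                   DominatesHead true n U → DominatesHead true n V →
                   RowInterlace θ R U V → RowInterlace θ L (prependIf T n U) (prependIf B n V)
interlace-extend Γ false false false false n U V _ n>U n>V I = I
interlace-extend Γ true  true  true  true  n U V _ n>U n>V I = ℕₚ.≤-refl , n>V , n>V , n>U , I
interlace-extend Γ true  false true  false n U V _ n>U n>V I = I
interlace-extend Γ true  false false true  n U V _ n>U n>V I = DominatesHead-strict⇒weak n U n>U , n>V , I
interlace-extend Γ false true  true  false n U V _ n>U n>V I = n>V , n>U , I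
interlace-extend Δ false false false false n U V _ n>U n>V I = I
interlace-extend Δ true  true  true  true  n U V _ n>U n>V I = ℕₚ.≤-refl , n>U , n>U , n>V , I
interlace-extend Δ true  false true  false n U V _ n>U n>V I = I
interlace-extend Δ false false true  true  n U V _ n>U n>V I = n>U , n>V , I
interlace-extend Δ true  true  false false n U V _ n>U n>V I = DominatesHead-strict⇒weak n V n>V , n>U , I

interlace-restrict : ∀ θ (L T B : Bool) n U V → DominatesHead true n U → DominatesHead true n V →
                     RowInterlace θ L (prependIf T n U) (prependIf B n V) →
                     Σ Bool λ R → Admissible θ L T R B × RowInterlace θ R U V
interlace-restrict Γ false false false n U       V       _   _   I             = false , tt , I
interlace-restrict Γ false false true  n []      V       _   _   ()
interlace-restrict Γ false false true  n (u ∷ U) V       u<n _   (n<u , _)     = ⊥-elim (ℕₚ.<-asym n<u u<n)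
interlace-restrict Γ false true  false n U       V       _   _   (_ , _ , I)   = true , tt , I
interlace-restrict Γ false true  true  n U       V       _   _   (n<n , _)     = ⊥-elim (ℕₚ.<-irrefl refl n<n)
interlace-restrict Γ true  false false n U       V       _   _   I             = true , tt , I
interlace-restrict Γ true  false true  n U       V       _   _   (_ , _ , I)   = false , tt , I
interlace-restrict Γ true  true  false n U       []      _   _   ()
interlace-restrict Γ true  true  false n U       (v ∷ V) _   v<n (n≤v , _)     = ⊥-elim (ℕₚ.<-irrefl refl (ℕₚ.<-≤-trans v<n n≤v))
interlace-restrict Γ true  true  true  n U       V       _   _   (_ , _ , _ , _ , I) = true , tt , I
interlace-restrict Δ true  false false n U       V       _   _   I             = true , tt , I
interlace-restrict Δ true  false true  n []      V       _   _   ()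
interlace-restrict Δ true  false true  n (u ∷ U) V       u<n _   (n≤u , _)     = ⊥-elim (ℕₚ.<-irrefl refl (ℕₚ.<-≤-trans u<n n≤u))
interlace-restrict Δ true  true  false n U       V       _   _   (_ , _ , I)   = false , tt , I
interlace-restrict Δ true  true  true  n U       V       _   _   (_ , _ , _ , _ , I) = true , tt , I
interlace-restrict Δ false false false n U       V       _   _   I             = false , tt , I
interlace-restrict Δ false false true  n U       V       _   _   (_ , _ , I)   = true , tt , I
interlace-restrict Δ false true  false n U       []      _   _   ()
interlace-restrict Δ false true  false n U       (v ∷ V) _   v<n (n<v , _)     = ⊥-elim (ℕₚ.<-asym n<v v<n)
interlace-restrict Δ false true  true  n U       V       _   _   (n<n , _)     = ⊥-elim (ℕₚ.<-irrefl refl n<n)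

admissibleRow⇒interlace : ∀ θ n TO BO HO → AdmissibleRow θ n TO BO HO → HO zero ≡ not (leftBoundary θ) →
                          RowInterlace θ (HO (fromℕ n)) (occupiedColumns n TO) (occupiedColumns n BO)
admissibleRow⇒interlace Γ zero TO BO HO _ HO₀ rewrite HO₀ = refl
admissibleRow⇒interlace Δ zero TO BO HO _ HO₀ rewrite HO₀ = refl
admissibleRow⇒interlace θ (suc n) TO BO HO adm HO₀ =
  interlace-extend θ (HO (fromℕ (suc n))) (TO (fromℕ n)) (HO (inject₁ (fromℕ n))) (BO (fromℕ n)) n _ _
    (adm (fromℕ n)) (occupiedColumns-bounded n _) (occupiedColumns-bounded n _)
    (admissibleRow⇒interlace θ n (V.init TO) (V.init BO) (V.init HO) (adm ∘ inject₁) HO₀)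

interlace⇒admissibleRow : ∀ θ n TO BO L → RowInterlace θ L (occupiedColumns n TO) (occupiedColumns n BO) →
  Σ (Fin (suc n) → Bool) λ HO → AdmissibleRow θ n TO BO HO × HO (fromℕ n) ≡ L × HO zero ≡ not (leftBoundary θ)
interlace⇒admissibleRow θ zero    TO BO L I = (λ _ → L) , (λ ()) , refl , RowInterlace-[] θ L I
interlace⇒admissibleRow θ (suc n) TO BO L I = HO , adm , snoc-fromℕ (proj₁ rest) L , HO₀
  where
  step = interlace-restrict θ L (TO (fromℕ n)) (BO (fromℕ n)) n _ _
           (occupiedColumns-bounded n _) (occupiedColumns-bounded n _) I
  rest = interlace⇒admissibleRow θ n (V.init TO) (V.init BO) (proj₁ step) (proj₂ (proj₂ step))
  HO = snoc (proj₁ rest) L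

  HO₀ : HO zero ≡ not (leftBoundary θ)
  HO₀ = trans (snoc-inject₁ (proj₁ rest) L zero) (proj₂ (proj₂ (proj₂ rest)))

  adm : AdmissibleRow θ (suc n) TO BO HO
  adm j with view j
  ... | ‵fromℕ rewrite snoc-fromℕ (proj₁ rest) L | snoc-inject₁ (proj₁ rest) L (fromℕ n)
                     | proj₁ (proj₂ (proj₂ rest)) = proj₁ (proj₂ step)
  ... | ‵inject₁ k rewrite snoc-inject₁ (proj₁ rest) L (suc k) | snoc-inject₁ (proj₁ rest) L (inject₁ k)
                         = proj₁ (proj₂ rest) k

-- Exponents of the weight

-- The power of z contributed by a nonzero vertex, read off its left edge.
exponent : VType → Bool → ℕ
exponent Γ L = count L
exponent Δ L = count (not L)

-- Paths are conserved at a vertex: they move rightwards in a Γ row and leftwards in a Δ row.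
conservationΓ : ∀ {L T R B} → Admissible Γ L T R B → count T + count L ≡ count R + count B
conservationΓ {false} {false} {false} {false} _ = refl
conservationΓ {true}  {true}  {true}  {true}  _ = refl
conservationΓ {true}  {false} {true}  {false} _ = refl
conservationΓ {true}  {false} {false} {true}  _ = refl
conservationΓ {false} {true}  {true}  {false} _ = refl

conservationΔ : ∀ {L T R B} → Admissible Δ L T R B → count T + count R ≡ count L + count B
conservationΔ {false} {false} {false} {false} _ = refl
conservationΔ {true}  {true}  {true}  {true}  _ = refl
conservationΔ {true}  {false} {true}  {false} _ = refl
conservationΔ {false} {false} {true}  {true}  _ = refl
conservationΔ {true}  {true}  {false} {false} _ = refl

sum-prependIf : ∀ b n U → sum (prependIf b n U) ≡ count b * n + sum U
sum-prependIf true  n U = cong (_+ sum U) (sym (ℕₚ.+-identityʳ n))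
sum-prependIf false n U = refl

module ℕSum = MonoidSum ℕₚ.+-0-monoid

exponentSum : VType → (n : ℕ) → (Fin (suc n) → Bool) → ℕ
exponentSum θ n HO = ℕSum.sum (λ j → exponent θ (HO (suc j)))

balanceΓ : ∀ {E sU sV n l t r b} → t + l ≡ r + b → E + sV ≡ sU + n * r →
           (E + l) + (b * n + sV) ≡ (t * n + sU) + suc n * l
balanceΓ {E} {sU} {sV} {n} {l} {t} {r} {b} cons ih = begin
  (E + l) + (b * n + sV)   ≡⟨ solve (E ∷ l ∷ b ∷ n ∷ sV ∷ []) ⟩
  (E + sV) + (l + n * b)   ≡⟨ cong (_+ (l + n * b)) ih ⟩
  (sU + n * r) + (l + n * b) ≡⟨ solve (sU ∷ n ∷ r ∷ l ∷ b ∷ []) ⟩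
  sU + l + n * (r + b)     ≡⟨ cong (λ x → sU + l + n * x) (sym cons) ⟩
  sU + l + n * (t + l)     ≡⟨ solve (sU ∷ l ∷ n ∷ t ∷ []) ⟩
  (t * n + sU) + suc n * l ∎
  where open ≡-Reasoning

balanceΔ : ∀ {E sU sV n e l t r b} → e + l ≡ 1 → t + r ≡ l + b → E + sV + n * r ≡ n + sU →
           (E + e) + (b * n + sV) + suc n * l ≡ suc n + (t * n + sU)
balanceΔ {E} {sU} {sV} {n} {e} {l} {t} {r} {b} e+l≡1 cons ih = ℕₚ.+-cancelʳ-≡ (n * r) _ _ (begin
  (E + e) + (b * n + sV) + suc n * l + n * r ≡⟨ solve (E ∷ e ∷ b ∷ n ∷ sV ∷ l ∷ r ∷ []) ⟩
  (E + sV + n * r) + (e + l) + n * (l + b)   ≡⟨ cong₂ (λ x y → x + y + n * (l + b)) ih e+l≡1 ⟩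
  (n + sU) + 1 + n * (l + b)                 ≡⟨ cong (λ x → n + sU + 1 + n * x) (sym cons) ⟩
  (n + sU) + 1 + n * (t + r)                 ≡⟨ solve (n ∷ sU ∷ t ∷ r ∷ []) ⟩
  suc n + (t * n + sU) + n * r               ∎)
  where open ≡-Reasoning

rowBalanceΓ : ∀ n TO BO HO → AdmissibleRow Γ n TO BO HO →
  exponentSum Γ n HO + sum (occupiedColumns n BO) ≡ sum (occupiedColumns n TO) + n * count (HO (fromℕ n))
rowBalanceΓ zero    TO BO HO adm = refl
rowBalanceΓ (suc n) TO BO HO adm = begin
  exponentSum Γ (suc n) HO + sum (occupiedColumns (suc n) BO)
    ≡⟨ cong₂ _+_ (ℕSum.sum-init-last (λ j → exponent Γ (HO (suc j)))) (sum-prependIf (BO (fromℕ n)) n _) ⟩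
  (exponentSum Γ n (V.init HO) + count (HO (fromℕ (suc n)))) + (count (BO (fromℕ n)) * n + sum (occupiedColumns n (V.init BO)))
    ≡⟨ balanceΓ {E = exponentSum Γ n (V.init HO)} {n = n} (conservationΓ (adm (fromℕ n)))
                (rowBalanceΓ n (V.init TO) (V.init BO) (V.init HO) (adm ∘ inject₁)) ⟩
  (count (TO (fromℕ n)) * n + sum (occupiedColumns n (V.init TO))) + suc n * count (HO (fromℕ (suc n)))
    ≡⟨ cong (_+ suc n * count (HO (fromℕ (suc n)))) (sym (sum-prependIf (TO (fromℕ n)) n _)) ⟩
  sum (occupiedColumns (suc n) TO) + suc n * count (HO (fromℕ (suc n))) ∎
  where open ≡-Reasoning

rowBalanceΔ : ∀ n TO BO HO → AdmissibleRow Δ n TO BO HO →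
  exponentSum Δ n HO + sum (occupiedColumns n BO) + n * count (HO (fromℕ n)) ≡ n + sum (occupiedColumns n TO)
rowBalanceΔ zero    TO BO HO adm = refl
rowBalanceΔ (suc n) TO BO HO adm = begin
  exponentSum Δ (suc n) HO + sum (occupiedColumns (suc n) BO) + suc n * count (HO (fromℕ (suc n)))
    ≡⟨ cong₂ (λ x y → x + y + suc n * count (HO (fromℕ (suc n))))
             (ℕSum.sum-init-last (λ j → exponent Δ (HO (suc j)))) (sum-prependIf (BO (fromℕ n)) n _) ⟩
  (exponentSum Δ n (V.init HO) + count (not (HO (fromℕ (suc n)))))
    + (count (BO (fromℕ n)) * n + sum (occupiedColumns n (V.init BO))) + suc n * count (HO (fromℕ (suc n)))
    ≡⟨ balanceΔ {E = exponentSum Δ n (V.init HO)} {n = n} (count-not (HO (fromℕ (suc n))))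
                (conservationΔ (adm (fromℕ n)))
                (rowBalanceΔ n (V.init TO) (V.init BO) (V.init HO) (adm ∘ inject₁)) ⟩
  suc n + (count (TO (fromℕ n)) * n + sum (occupiedColumns n (V.init TO)))
    ≡⟨ cong (suc n +_) (sym (sum-prependIf (TO (fromℕ n)) n _)) ⟩
  suc n + sum (occupiedColumns (suc n) TO) ∎
  where open ≡-Reasoning

rowExponent : ∀ θ n TO BO HO → AdmissibleRow θ n TO BO HO → HO (fromℕ n) ≡ leftBoundary θ →
              exponentSum θ n HO + sum (occupiedColumns n BO) ≡ sum (occupiedColumns n TO)
rowExponent Γ n TO BO HO adm left = begin
  e + b          ≡⟨ subst (λ c → e + b ≡ t + n * count c) left (rowBalanceΓ n TO BO HO adm) ⟩
  t + n * 0      ≡⟨ cong (t +_) (ℕₚ.*-zeroʳ n) ⟩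
  t + 0          ≡⟨ ℕₚ.+-identityʳ t ⟩
  t              ∎
  where
  open ≡-Reasoning
  e = exponentSum Γ n HO
  b = sum (occupiedColumns n BO)
  t = sum (occupiedColumns n TO)
rowExponent Δ n TO BO HO adm left = ℕₚ.+-cancelʳ-≡ n _ _ (begin
  e + b + n      ≡⟨ cong (e + b +_) (sym (ℕₚ.*-identityʳ n)) ⟩
  e + b + n * 1  ≡⟨ subst (λ c → e + b + n * count c ≡ n + t) left (rowBalanceΔ n TO BO HO adm) ⟩
  n + t          ≡⟨ ℕₚ.+-comm n t ⟩
  t + n          ∎)
  where
  open ≡-Reasoning
  e = exponentSum Δ n HO
  b = sum (occupiedColumns n BO)
  t = sum (occupiedColumns n TO)

horOcc : ∀ {m r N} → Labelling m r N → Fin r → Fin (suc N) → Bool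
horOcc L t k = occupied (hor L t k)

cutOcc : ∀ {m r N} → Labelling m r N → Fin (suc r) → Fin N → Bool
cutOcc L k j = occupied (ver L k j)

rowExponentOf : ∀ {m r N} → (Fin r → VType) → Labelling m r N → Fin r → ℕ
rowExponentOf {N = N} Θ L t = exponentSum (Θ t) N (horOcc L t)

module Weights {c ℓ} (R : CommutativeRing c ℓ) where
  open CommutativeRing R
    using (_≈_; _*_; *-congˡ; *-identityʳ; setoid; semiring; *-commutativeMonoid)
    renaming (Carrier to A; refl to ≈-refl; sym to ≈-sym; trans to ≈-trans; reflexive to ≈-reflexive)
  open SemiringExp semiring using (_^_; ^-homo-*)
  module ∏ = CommutativeMonoidSum *-commutativeMonoid

  prodFin≈∏ : ∀ n (f : Fin n → A) → prodFin R n f ≈ ∏.sum f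
  prodFin≈∏ zero    f = ≈-refl
  prodFin≈∏ (suc n) f = *-congˡ (prodFin≈∏ n (f ∘ suc))

  ∏-^ : ∀ n x (e : Fin n → ℕ) → ∏.sum (λ j → x ^ e j) ≈ x ^ ℕSum.sum e
  ∏-^ zero    x e = ≈-refl
  ∏-^ (suc n) x e = ≈-trans (*-congˡ (∏-^ n x (e ∘ suc))) (≈-sym (^-homo-* x (e zero) (ℕSum.sum (e ∘ suc))))

  evW-leftWeight : ∀ θ L x → evW R (leftWeight θ L) x ≈ x ^ exponent θ L
  evW-leftWeight Γ true  x = ≈-sym (*-identityʳ x)
  evW-leftWeight Γ false x = ≈-refl
  evW-leftWeight Δ true  x = ≈-refl
  evW-leftWeight Δ false x = ≈-sym (*-identityʳ x)

  wt≈∏^rowExponent : ∀ {m r N} (Θ : Fin r → VType) (L : Labelling m r N) → (∀ t j → vertexW Θ L t j ≢ w0) →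
                     ∀ z → wt R Θ L z ≈ ∏.sum (λ t → z t ^ rowExponentOf Θ L t)
  wt≈∏^rowExponent {r = r} {N} Θ L nonzero z = begin
    wt R Θ L z
      ≈⟨ prodFin≈∏ r _ ⟩
    ∏.sum (λ t → prodFin R N (λ j → evW R (vertexW Θ L t j) (z t)))
      ≈⟨ ∏.sum-cong-≋ {r} (λ t → prodFin≈∏ N _) ⟩
    ∏.sum (λ t → ∏.sum (λ j → evW R (vertexW Θ L t j) (z t)))
      ≈⟨ ∏.sum-cong-≋ {r} (λ t → ∏.sum-cong-≋ {N} (vertex t)) ⟩
    ∏.sum (λ t → ∏.sum (λ j → z t ^ exponent (Θ t) (horOcc L t (suc j))))
      ≈⟨ ∏.sum-cong-≋ {r} (λ t → ∏-^ N (z t) _) ⟩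
    ∏.sum (λ t → z t ^ rowExponentOf Θ L t)
      ∎
    where
    open import Relation.Binary.Reasoning.Setoid setoid
    vertex : ∀ t j → evW R (vertexW Θ L t j) (z t) ≈ z t ^ exponent (Θ t) (horOcc L t (suc j))
    vertex t j = ≈-trans (≈-reflexive (cong (λ w → evW R w (z t)) (proj₂ (nonzero-vertex (Θ t) _ _ _ _ (nonzero t j)))))
                       (evW-leftWeight (Θ t) _ (z t))

-- The Bender–Knuth toggle

head₀ : List ℕ → ℕ
head₀ []      = 0
head₀ (x ∷ _) = x

-- The Bender–Knuth toggle of the middle row Y between X above and Z below; z₋ is the entry of Z
-- left of the current window (nothing at the start).  Indices follow newRowFrom.
toggleFrom : Maybe ℕ → List ℕ → List ℕ → List ℕ → List ℕ
toggleFrom z₋ X Z []      = []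
toggleFrom z₋ X Z (y ∷ Y) =
  (minM (head₀ X) z₋ + maxM (head₀ (drop 1 X)) (head Z) ∸ y) ∷ toggleFrom (head Z) (drop 1 X) (drop 1 Z) Y

toggle : List ℕ → List ℕ → List ℕ → List ℕ
toggle = toggleFrom nothing

DominatesM : Bool → Maybe ℕ → ℕ → Set
DominatesM s nothing  y = ⊤
DominatesM s (just z) y = Dominates s z y

DominatesHeadM : Maybe ℕ → List ℕ → Set
DominatesHeadM nothing  Z = ⊤
DominatesHeadM (just z) Z = DominatesHead true z Z

InterlaceFrom : Bool → Bool → Maybe ℕ → List ℕ → List ℕ → Set
InterlaceFrom a b nothing  Y Z = Interlace a b Y Z
InterlaceFrom a b (just z) Y Z = Interlace₌ a b Y (z ∷ Z)

InterlaceFrom-∷⁻ : ∀ a b z₋ y Y Z → InterlaceFrom a b z₋ (y ∷ Y) Z →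
                   DominatesM a z₋ y × DominatesHeadM z₋ Z × Interlace a b (y ∷ Y) Z
InterlaceFrom-∷⁻ a b nothing  y Y Z I                = tt , tt , I
InterlaceFrom-∷⁻ a b (just z) y Y Z (y≺z , z>Z , I) = y≺z , z>Z , I

InterlaceFrom-∷ : ∀ a b z₋ y Y Z → DominatesM a z₋ y → DominatesHeadM z₋ Z → Interlace a b (y ∷ Y) Z →
                  InterlaceFrom a b z₋ (y ∷ Y) Z
InterlaceFrom-∷ a b nothing  y Y Z _   _   I = I
InterlaceFrom-∷ a b (just z) y Y Z y≺z z>Z I = y≺z , z>Z , I

minM≤ : ∀ x z₋ → minM x z₋ ≤ x
minM≤ x nothing  = ℕₚ.≤-refl
minM≤ x (just z) = ℕₚ.m⊓n≤m x z

minM-dominates : ∀ s x z₋ {y} → Dominates s x y → DominatesM s z₋ y → Dominates s (minM x z₋) y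
minM-dominates s x nothing  y≺x _   = y≺x
minM-dominates s x (just z) y≺x y≺z = dominates-⊓ s y≺x y≺z

minM-dominatesM : ∀ s x z₋ {t} → Dominates s (minM x z₋) t → DominatesM s z₋ t
minM-dominatesM s x nothing  _   = tt
minM-dominatesM s x (just z) t≺m = ℕₚ.≤-trans t≺m (ℕₚ.m⊓n≤n x z)

⊓+⊔ : ∀ m n → (m ⊓ n) + (m ⊔ n) ≡ m + n
⊓+⊔ m n with ℕₚ.≤-total m n
... | inj₁ m≤n rewrite ℕₚ.m≤n⇒m⊓n≡m m≤n | ℕₚ.m≤n⇒m⊔n≡n m≤n = refl
... | inj₂ n≤m rewrite ℕₚ.m≥n⇒m⊓n≡n n≤m | ℕₚ.m≥n⇒m⊔n≡m n≤m = ℕₚ.+-comm n m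

toggle-sum-last : ∀ {t₀ y₀ x₀ x₁ m} → t₀ + y₀ ≡ m + x₁ → (t₀ + 0) + (y₀ + 0) + x₀ ≡ m + (x₀ + (x₁ + 0)) + 0
toggle-sum-last {t₀} {y₀} {x₀} {x₁} {m} e = begin
  (t₀ + 0) + (y₀ + 0) + x₀ ≡⟨ solve (t₀ ∷ y₀ ∷ x₀ ∷ []) ⟩
  (t₀ + y₀) + x₀           ≡⟨ cong (_+ x₀) e ⟩
  (m + x₁) + x₀            ≡⟨ solve (m ∷ x₁ ∷ x₀ ∷ []) ⟩
  m + (x₀ + (x₁ + 0)) + 0  ∎
  where open ≡-Reasoning

toggle-sum-step : ∀ {t₀ y₀ x₀ x₁ z₀ m mn mx sY′ sY sX sZ} →
  t₀ + y₀ ≡ m + mx → sY′ + sY + x₁ ≡ mn + (x₁ + sX) + sZ → mn + mx ≡ x₁ + z₀ →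
  (t₀ + sY′) + (y₀ + sY) + x₀ ≡ m + (x₀ + (x₁ + sX)) + (z₀ + sZ)
toggle-sum-step {t₀} {y₀} {x₀} {x₁} {z₀} {m} {mn} {mx} {sY′} {sY} {sX} {sZ} e₁ e₂ e₃ =
  ℕₚ.+-cancelʳ-≡ x₁ _ _ (begin
    (t₀ + sY′) + (y₀ + sY) + x₀ + x₁       ≡⟨ solve (t₀ ∷ sY′ ∷ y₀ ∷ sY ∷ x₀ ∷ x₁ ∷ []) ⟩
    (t₀ + y₀) + (sY′ + sY + x₁) + x₀       ≡⟨ cong₂ (λ a b → a + b + x₀) e₁ e₂ ⟩
    (m + mx) + (mn + (x₁ + sX) + sZ) + x₀  ≡⟨ solve (m ∷ mx ∷ mn ∷ x₁ ∷ sX ∷ sZ ∷ x₀ ∷ []) ⟩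
    m + (mn + mx) + x₁ + sX + sZ + x₀      ≡⟨ cong (λ w → m + w + x₁ + sX + sZ + x₀) e₃ ⟩
    m + (x₁ + z₀) + x₁ + sX + sZ + x₀      ≡⟨ solve (m ∷ x₁ ∷ z₀ ∷ sX ∷ sZ ∷ x₀ ∷ []) ⟩
    m + (x₀ + (x₁ + sX)) + (z₀ + sZ) + x₁  ∎)
  where open ≡-Reasoning

ToggleResult : Bool → Maybe ℕ → List ℕ → List ℕ → List ℕ → Set
ToggleResult b z₋ X Y Z =
  Interlace b (not b) X (toggleFrom z₋ X Z Y) × InterlaceFrom (not b) b z₋ (toggleFrom z₋ X Z Y) Z ×
  (sum (toggleFrom z₋ X Z Y) + sum Y + head₀ X ≡ minM (head₀ X) z₋ + sum X + sum Z)

toggle-last-window : ∀ b z₋ x₀ x₁ y₀ → Interlace (not b) b (x₀ ∷ x₁ ∷ []) (y₀ ∷ []) →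
                     InterlaceFrom b (not b) z₋ (y₀ ∷ []) [] → ToggleResult b z₋ (x₀ ∷ x₁ ∷ []) (y₀ ∷ []) []
toggle-last-window b z₋ x₀ x₁ y₀ (y₀≺x₀ , x₁<x₀ , x₁≼y₀ , _ , _ , _ , refl) I↓ =
  (dominates-≤ˡ (not b) t₀≼m (minM≤ x₀ z₋) , x₁<x₀ , balance-dominatesˡ b e y₀≺m , tt , tt , tt , refl) ,
  InterlaceFrom-∷ (not b) b z₋ t₀ [] [] (minM-dominatesM (not b) x₀ z₋ t₀≼m) (proj₁ (proj₂ I↓′)) (tt , tt , refl) ,
  toggle-sum-last {t₀} {y₀} {x₀} {x₁} {m} e
  where
  I↓′ = InterlaceFrom-∷⁻ b (not b) z₋ y₀ [] [] I↓
  m = minM x₀ z₋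
  t₀ = m + x₁ ∸ y₀
  y₀≺m = minM-dominates b x₀ z₋ y₀≺x₀ (proj₁ I↓′)
  e : t₀ + y₀ ≡ m + x₁
  e = ℕₚ.m∸n+n≡m (ℕₚ.≤-trans (dominates⇒≤ b y₀≺m) (ℕₚ.m≤m+n m x₁))
  t₀≼m = balance-dominatesʳ (not b) e x₁≼y₀

toggle-window-step : ∀ b z₋ x₀ x₁ X y₀ y₁ Y z₀ Z →
  Interlace (not b) b (x₀ ∷ x₁ ∷ X) (y₀ ∷ y₁ ∷ Y) → InterlaceFrom b (not b) z₋ (y₀ ∷ y₁ ∷ Y) (z₀ ∷ Z) →
  ToggleResult b (just z₀) (x₁ ∷ X) (y₁ ∷ Y) Z → ToggleResult b z₋ (x₀ ∷ x₁ ∷ X) (y₀ ∷ y₁ ∷ Y) (z₀ ∷ Z)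
toggle-window-step b z₋ x₀ x₁ X y₀ y₁ Y z₀ Z (y₀≺x₀ , x₁<x₀ , x₁≼y₀ , _) I↓ (I↑″ , I↓″ , Σ″) =
  (dominates-≤ˡ (not b) t₀≼m (minM≤ x₀ z₋) , x₁<x₀ , dominates-≤ʳ b M≺t₀ (ℕₚ.m≤m⊔n x₁ z₀) , t₁<t₀ , I↑″) ,
  InterlaceFrom-∷ (not b) b z₋ t₀ rest (z₀ ∷ Z) (minM-dominatesM (not b) x₀ z₋ t₀≼m) z₋>Z (z₀≺t₀ , t₁<t₀ , I↓″) ,
  toggle-sum-step {t₀} {y₀} {x₀} {x₁} {z₀} {m} {x₁ ⊓ z₀} {M} {sum rest} e Σ″ (⊓+⊔ x₁ z₀)
  where
  I↓′ = InterlaceFrom-∷⁻ b (not b) z₋ y₀ (y₁ ∷ Y) (z₀ ∷ Z) I↓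
  y₀≺z₋ = proj₁ I↓′
  z₋>Z = proj₁ (proj₂ I↓′)
  z₀≼y₀ = proj₁ (proj₂ (proj₂ I↓′))
  rest = toggleFrom (just z₀) (x₁ ∷ X) Z (y₁ ∷ Y)
  m = minM x₀ z₋
  M = x₁ ⊔ z₀
  t₀ = m + M ∸ y₀
  y₀≺m = minM-dominates b x₀ z₋ y₀≺x₀ y₀≺z₋
  e : t₀ + y₀ ≡ m + M
  e = ℕₚ.m∸n+n≡m (ℕₚ.≤-trans (dominates⇒≤ b y₀≺m) (ℕₚ.m≤m+n m M))
  t₀≼m = balance-dominatesʳ (not b) e (dominates-⊔ (not b) x₁≼y₀ z₀≼y₀)
  M≺t₀ = balance-dominatesˡ b e y₀≺m
  z₀≺t₀ = dominates-≤ʳ b M≺t₀ (ℕₚ.m≤n⊔m x₁ z₀)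
  t₁<t₀ = dominates-chain b z₀≺t₀ (proj₁ I↓″)

toggleFrom-interlace : ∀ b z₋ X Y Z → Interlace (not b) b X Y → InterlaceFrom b (not b) z₋ Y Z →
                       ToggleResult b z₋ X Y Z
toggleFrom-interlace b z₋ X [] Z _ I↓ = ⊥-elim (no-empty z₋ I↓)
  where
  no-empty : ∀ z₋ → InterlaceFrom b (not b) z₋ [] Z → ⊥
  no-empty nothing  ()
  no-empty (just z) (_ , _ , ())
toggleFrom-interlace b z₋ (x₀ ∷ x₁ ∷ []) (y₀ ∷ []) [] I↑ I↓ = toggle-last-window b z₋ x₀ x₁ y₀ I↑ I↓
toggleFrom-interlace b z₋ (x₀ ∷ x₁ ∷ x₂ ∷ X) (y₀ ∷ []) [] (_ , _ , _ , _ , _ , _ , ()) I↓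
toggleFrom-interlace b z₋ (x₀ ∷ []) (y₀ ∷ []) [] (_ , _ , _ , _ , ()) I↓
toggleFrom-interlace b z₋ X (y₀ ∷ []) (z ∷ Z) I↑ I↓ with InterlaceFrom-∷⁻ b (not b) z₋ y₀ [] (z ∷ Z) I↓
... | _ , _ , _ , _ , _ , _ , ()
toggleFrom-interlace b z₋ X (y₀ ∷ y₁ ∷ Y) [] I↑ I↓ with InterlaceFrom-∷⁻ b (not b) z₋ y₀ (y₁ ∷ Y) [] I↓
... | _ , _ , _ , _ , ()
toggleFrom-interlace b z₋ (x₀ ∷ []) (y₀ ∷ y₁ ∷ Y) (z₀ ∷ Z) (_ , _ , _ , _ , ()) I↓
toggleFrom-interlace b z₋ (x₀ ∷ x₁ ∷ X) (y₀ ∷ y₁ ∷ Y) (z₀ ∷ Z) I↑ I↓ =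
  toggle-window-step b z₋ x₀ x₁ X y₀ y₁ Y z₀ Z I↑ I↓
    (toggleFrom-interlace b (just z₀) (x₁ ∷ X) (y₁ ∷ Y) Z (proj₂ (proj₂ (proj₂ (proj₂ I↑))))
                          (proj₂ (proj₂ (proj₂ (proj₂ (InterlaceFrom-∷⁻ b (not b) z₋ y₀ (y₁ ∷ Y) (z₀ ∷ Z) I↓))))))

cancel-head : ∀ {a h b c} → a + h ≡ h + b + c → a ≡ b + c
cancel-head {a} {h} {b} {c} e = ℕₚ.+-cancelʳ-≡ h a (b + c) (trans e (trans (ℕₚ.+-assoc h b c) (ℕₚ.+-comm h (b + c))))

toggle-interlace : ∀ θ₁ θ₂ → θ₁ ≢ θ₂ → ∀ X Y Z → InterlaceOf θ₁ X Y → InterlaceOf θ₂ Y Z →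
  InterlaceOf θ₂ X (toggle X Z Y) × InterlaceOf θ₁ (toggle X Z Y) Z × sum (toggle X Z Y) + sum Y ≡ sum X + sum Z
toggle-interlace Γ Γ Γ≢Γ X Y Z _ _ = ⊥-elim (Γ≢Γ refl)
toggle-interlace Δ Δ Δ≢Δ X Y Z _ _ = ⊥-elim (Δ≢Δ refl)
toggle-interlace Γ Δ _ X Y Z I↑ I↓ with toggleFrom-interlace true nothing X Y Z I↑ I↓
... | I↑′ , I↓′ , Σ = I↑′ , I↓′ , cancel-head Σ
toggle-interlace Δ Γ _ X Y Z I↑ I↓ with toggleFrom-interlace false nothing X Y Z I↑ I↓
... | I↑′ , I↓′ , Σ = I↑′ , I↓′ , cancel-head Σ

-- The involution on patterns

nthD-suc : ∀ x xs n → nthD (x ∷ xs) (suc n) ≡ nthD xs n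
nthD-suc x xs n with nth xs n
... | just _  = refl
... | nothing = refl

nthD≡head₀∘drop : ∀ xs n → nthD xs n ≡ head₀ (drop n xs)
nthD≡head₀∘drop []       zero    = refl
nthD≡head₀∘drop []       (suc n) = refl
nthD≡head₀∘drop (x ∷ xs) zero    = refl
nthD≡head₀∘drop (x ∷ xs) (suc n) = trans (nthD-suc x xs n) (nthD≡head₀∘drop xs n)

nth≡head∘drop : ∀ xs n → nth xs n ≡ head (drop n xs)
nth≡head∘drop []       zero    = refl
nth≡head∘drop []       (suc n) = refl
nth≡head∘drop (x ∷ xs) zero    = refl
nth≡head∘drop (x ∷ xs) (suc n) = nth≡head∘drop xs n

drop-suc : ∀ n (xs : List ℕ) → drop (suc n) xs ≡ drop 1 (drop n xs)
drop-suc zero    []       = refl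
drop-suc zero    (x ∷ xs) = refl
drop-suc (suc n) []       = refl
drop-suc (suc n) (x ∷ xs) = drop-suc n xs

entryLeft : List ℕ → ℕ → Maybe ℕ
entryLeft Z zero    = nothing
entryLeft Z (suc p) = nth Z p

window-entry : ∀ X Z p z₋ y →
  minM (nthD X p) z₋ + maxM (nthD X (suc p)) (nth Z p) ∸ y ≡
  minM (head₀ (drop p X)) z₋ + maxM (head₀ (drop 1 (drop p X))) (head (drop p Z)) ∸ y
window-entry X Z p z₋ y
  rewrite nthD≡head₀∘drop X p | nthD≡head₀∘drop X (suc p) | drop-suc p X | nth≡head∘drop Z p = refl

window-shift : ∀ p X Z Y →
  toggleFrom (entryLeft Z (suc p)) (drop (suc p) X) (drop (suc p) Z) Y ≡
  toggleFrom (head (drop p Z)) (drop 1 (drop p X)) (drop 1 (drop p Z)) Y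
window-shift p X Z Y rewrite nth≡head∘drop Z p | drop-suc p X | drop-suc p Z = refl

newRowFrom≡toggleFrom : ∀ p X Z Y → newRowFrom p X Z Y ≡ toggleFrom (entryLeft Z p) (drop p X) (drop p Z) Y
newRowFrom≡toggleFrom p       X Z []      = refl
newRowFrom≡toggleFrom zero    X Z (y ∷ Y) =
  cong₂ _∷_ (window-entry X Z 0 nothing y) (trans (newRowFrom≡toggleFrom 1 X Z Y) (window-shift 0 X Z Y))
newRowFrom≡toggleFrom (suc p) X Z (y ∷ Y) =
  cong₂ _∷_ (window-entry X Z (suc p) (nth Z p) y)
            (trans (newRowFrom≡toggleFrom (suc (suc p)) X Z Y) (window-shift (suc p) X Z Y))

tPat-row : ∀ r i P Z → (suc i < r → Z ≡ P (suc i)) → (¬ suc i < r → Z ≡ []) →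
           tPat r i P i ≡ toggle (P (i ∸ 1)) Z (P i)
tPat-row r i P Z below last rewrite dec-true (i ℕ.≟ i) refl with suc i <? r
... | yes i+1<r rewrite below i+1<r = newRowFrom≡toggleFrom 0 _ _ _
... | no  i+1≮r rewrite last i+1≮r  = newRowFrom≡toggleFrom 0 _ _ _

tPat-other : ∀ r i P k → k ≢ i → tPat r i P k ≡ P k
tPat-other r i P k k≢i rewrite dec-false (k ℕ.≟ i) k≢i = refl

StrictlyDecreasing : List ℕ → Set
StrictlyDecreasing []      = ⊤
StrictlyDecreasing (y ∷ Y) = DominatesHead true y Y × StrictlyDecreasing Y

interlace-decreasing : ∀ a b X Y → Interlace a b X Y → StrictlyDecreasing Y
interlace-decreasing a b (x ∷ X) []      _                   = tt
interlace-decreasing a b (x ∷ X) (y ∷ Y) (_ , _ , _ , y>Y , I) = y>Y , interlace-decreasing a b X Y I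

interlace-bounded : ∀ a b n X Y → Interlace a b X Y → DominatesHead true n X → DominatesHead true n Y
interlace-bounded a b n (x ∷ X) []      _         _   = tt
interlace-bounded a b n (x ∷ X) (y ∷ Y) (y≼x , _) x<n = ℕₚ.≤-<-trans (dominates⇒≤ b y≼x) x<n

occupiedColumns-snoc : ∀ n O b → occupiedColumns (suc n) (snoc O b) ≡ prependIf b n (occupiedColumns n O)
occupiedColumns-snoc n O b =
  cong₂ (λ b U → prependIf b n U) (snoc-fromℕ O b) (occupiedColumns-cong n (snoc-inject₁ O b))

realise : ∀ n Y → DominatesHead true n Y → StrictlyDecreasing Y → Σ (Fin n → Bool) λ O → occupiedColumns n O ≡ Y
realise zero    []      _   _ = (λ ()) , refl
realise (suc n) []      _   _ = (λ _ → false) , occupiedColumns-none n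
realise (suc n) (y ∷ Y) y≤n (y>Y , Y↓) with y ℕ.≟ n
... | yes refl = snoc (proj₁ rest) true , trans (occupiedColumns-snoc n _ true) (cong (n ∷_) (proj₂ rest))
  where rest = realise n Y y>Y Y↓
... | no y≢n = snoc (proj₁ rest) false , trans (occupiedColumns-snoc n _ false) (proj₂ rest)
  where rest = realise n (y ∷ Y) (ℕₚ.≤∧≢⇒< (ℕₚ.≤-pred y≤n) y≢n) (y>Y , Y↓)

-- Skeletons and states

RowSkeleton : VType → (n : ℕ) → (Fin n → Bool) → (Fin n → Bool) → (Fin (suc n) → Bool) → Set
RowSkeleton θ n TO BO HO =
  AdmissibleRow θ n TO BO HO × HO (fromℕ n) ≡ leftBoundary θ × HO zero ≡ not (leftBoundary θ)

RowSkeleton-cong : ∀ {θ n TO TO′ BO BO′ HO HO′} → TO ≗ TO′ → BO ≗ BO′ → HO ≗ HO′ →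
                   RowSkeleton θ n TO BO HO → RowSkeleton θ n TO′ BO′ HO′
RowSkeleton-cong {θ} {n} {TO′ = TO′} {BO′ = BO′} {HO′ = HO′} TO≗ BO≗ HO≗ (adm , left , right) =
  adm′ , trans (sym (HO≗ (fromℕ n))) left , trans (sym (HO≗ zero)) right
  where
  adm′ : AdmissibleRow θ n TO′ BO′ HO′
  adm′ j rewrite sym (TO≗ j) | sym (BO≗ j) | sym (HO≗ (suc j)) | sym (HO≗ (inject₁ j)) = adm j

RowSkeleton⇒interlace : ∀ θ n TO BO HO → RowSkeleton θ n TO BO HO →
                        InterlaceOf θ (occupiedColumns n TO) (occupiedColumns n BO)
RowSkeleton⇒interlace θ n TO BO HO (adm , left , right) = RowInterlace-leftBoundary θ
  (subst (λ L → RowInterlace θ L _ _) left (admissibleRow⇒interlace θ n TO BO HO adm right))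

interlace⇒RowSkeleton : ∀ θ n TO BO → InterlaceOf θ (occupiedColumns n TO) (occupiedColumns n BO) →
                        Σ (Fin (suc n) → Bool) (RowSkeleton θ n TO BO)
interlace⇒RowSkeleton θ n TO BO I = interlace⇒admissibleRow θ n TO BO (leftBoundary θ) (InterlaceOf⇒RowInterlace θ I)

colourRow : ∀ {m} θ n {TO BO HO} → RowSkeleton θ n TO BO HO →
            (T : Fin n → Label m) → (∀ j → occupied (T j) ≡ TO j) → RowColouring θ n T BO HO
colourRow Γ n (adm , left , _)  T T-occ = proj₁ (colourRowΓ n adm T T-occ nothing (sym left))
colourRow Δ n (adm , _ , right) T T-occ = proj₁ (colourRowΔ n adm T T-occ nothing (sym right))

-- The occupancy pattern of a state, forgetting its colours.
record Skeleton {r} (N : ℕ) (Θ : Fin r → VType) : Set where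
  field
    cut  : Fin (suc r) → Fin N → Bool
    row  : Fin r → Fin (suc N) → Bool
    rows : ∀ t → RowSkeleton (Θ t) N (cut (inject₁ t)) (cut (suc t)) (row t)

record Colouring {m r N} {Θ : Fin r → VType} (S : Skeleton N Θ) (top : Fin N → Label m) : Set where
  field
    labelling : Labelling m r N
    top-ver   : ∀ j → ver labelling zero j ≡ top j
    cut-occ   : ∀ k j → cutOcc labelling k j ≡ Skeleton.cut S k j
    row-occ   : ∀ t k → horOcc labelling t k ≡ Skeleton.row S t k
    nonzero   : ∀ t j → vertexW Θ labelling t j ≢ w0

colour : ∀ {m r N} {Θ : Fin r → VType} (S : Skeleton N Θ) (top : Fin N → Label m) →
         (∀ j → occupied (top j) ≡ Skeleton.cut S zero j) → Colouring S top
colour {r = zero} S top top-occ = record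
  { labelling = record { hor = λ () ; ver = λ _ → top }
  ; top-ver = λ _ → refl ; cut-occ = λ { zero → top-occ } ; row-occ = λ () ; nonzero = λ () }
colour {r = suc r} {N} {Θ} S top top-occ = record
  { labelling = L ; top-ver = λ _ → refl ; cut-occ = cut-occ ; row-occ = row-occ ; nonzero = nonzero }
  where
  module S = Skeleton S
  module R₀ = RowColouring (colourRow (Θ zero) N {HO = S.row zero} (S.rows zero) top top-occ)
  S₊ : Skeleton N (Θ ∘ suc)
  S₊ = record { cut = S.cut ∘ suc ; row = S.row ∘ suc ; rows = S.rows ∘ suc }
  module C₊ = Colouring (colour S₊ R₀.bottom R₀.botOcc)

  L : Labelling _ (suc r) N
  L = record { hor = R₀.horizontal V.∷ hor C₊.labelling ; ver = top V.∷ ver C₊.labelling }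

  cut-occ : ∀ k j → cutOcc L k j ≡ S.cut k j
  cut-occ zero    = top-occ
  cut-occ (suc k) = C₊.cut-occ k

  row-occ : ∀ t k → horOcc L t k ≡ S.row t k
  row-occ zero    = R₀.horOcc
  row-occ (suc t) = C₊.row-occ t

  nonzero : ∀ t j → vertexW Θ L t j ≢ w0
  nonzero zero    j rewrite C₊.top-ver j = R₀.nonzero j
  nonzero (suc t) j = C₊.nonzero t j

cutList : ∀ {m r N} → Labelling m r N → Fin (suc r) → List ℕ
cutList {N = N} L k = occupiedColumns N (cutOcc L k)

ι≡cutList : ∀ {m r N} (L : Labelling m r N) (k : Fin (suc r)) → ι L (toℕ k) ≡ cutList L k
ι≡cutList {r = r} {N} L k with toℕ k <? suc r
... | yes k<1+r rewrite Fₚ.fromℕ<-toℕ k k<1+r = occList≡occupiedColumns N _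
... | no  k≮1+r = contradiction (Fₚ.toℕ<n k) k≮1+r

ι≡cutList-row : ∀ {m r N} (L : Labelling m r N) (k : Fin r) → ι L (toℕ k) ≡ cutList L (inject₁ k)
ι≡cutList-row L k = trans (cong (ι L) (sym (Fₚ.toℕ-inject₁ k))) (ι≡cutList L (inject₁ k))

module _ {m r N κ λ' Θ} (s : State m r N κ λ' Θ) where
  open IsState (isState s)

  stateSkeleton : Skeleton N Θ
  stateSkeleton = record { cut = cutOcc (lab s) ; row = horOcc (lab s) ; rows = rows }
    where
    rows : ∀ t → RowSkeleton (Θ t) N (cutOcc (lab s) (inject₁ t)) (cutOcc (lab s) (suc t)) (horOcc (lab s) t)
    rows t = (λ j → proj₁ (nonzero-vertex (Θ t) _ _ _ _ (nonzero t j))) , boundaries t (Θ t) refl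
      where
      boundaries : ∀ t θ → Θ t ≡ θ →
                   horOcc (lab s) t (fromℕ N) ≡ leftBoundary θ × horOcc (lab s) t zero ≡ not (leftBoundary θ)
      boundaries t Γ Θt = ≡nothing⇒occupied≡false _ (leftΓ t Θt) , ≢nothing⇒occupied≡true _ (rightΓ t Θt)
      boundaries t Δ Θt = ≢nothing⇒occupied≡true _ (leftΔ t Θt) , ≡nothing⇒occupied≡false _ (rightΔ t Θt)

  cutList-bottom : cutList (lab s) (fromℕ r) ≡ []
  cutList-bottom = trans (occupiedColumns-cong N (λ j → ≡nothing⇒occupied≡false _ (botEmpty j))) (occupiedColumns-none N)

  row-interlace : ∀ t → InterlaceOf (Θ t) (cutList (lab s) (inject₁ t)) (cutList (lab s) (suc t))
  row-interlace t = RowSkeleton⇒interlace (Θ t) N (cutOcc (lab s) (inject₁ t)) (cutOcc (lab s) (suc t))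
                                          (horOcc (lab s) t) (Skeleton.rows stateSkeleton t)

  rowExponent-drop : ∀ t → rowExponentOf Θ (lab s) t + sum (cutList (lab s) (suc t)) ≡ sum (cutList (lab s) (inject₁ t))
  rowExponent-drop t with Skeleton.rows stateSkeleton t
  ... | adm , left , _ = rowExponent (Θ t) N (cutOcc (lab s) (inject₁ t)) (cutOcc (lab s) (suc t)) (horOcc (lab s) t) adm left

  cutList-determined : (C : Fin (suc r) → List ℕ) → C (fromℕ r) ≡ [] →
                       (∀ (k : Fin r) → ι (lab s) (toℕ k) ≡ C (inject₁ k)) → ∀ k → cutList (lab s) k ≡ C k
  cutList-determined C C-bottom ι≡C k with view k
  ... | ‵fromℕ     = trans cutList-bottom (sym C-bottom)
  ... | ‵inject₁ k = trans (sym (ι≡cutList-row (lab s) k)) (ι≡C k)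

  colouring-isState : ∀ {Θ′} (S : Skeleton N Θ′) (C : Colouring S (ver (lab s) zero)) →
                      (∀ j → Skeleton.cut S (fromℕ r) j ≡ false) → IsState κ λ' Θ′ (Colouring.labelling C)
  colouring-isState {Θ′} S C bottom-empty = record
    { nonzero  = C.nonzero
    ; topOcc   = λ t j j≡ → trans (C.top-ver j) (topOcc t j j≡)
    ; topEmpty = λ j j≢ → trans (C.top-ver j) (topEmpty j j≢)
    ; botEmpty = λ j → occupied≡false⇒≡nothing _ (trans (C.cut-occ (fromℕ r) j) (bottom-empty j))
    ; leftΓ    = λ t Θt → occupied≡false⇒≡nothing _ (left t Θt)
    ; rightΓ   = λ t Θt → occupied≡true⇒≢nothing _ (right t Θt)
    ; rightΔ   = λ t Θt → occupied≡false⇒≡nothing _ (right t Θt)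
    ; leftΔ    = λ t Θt → occupied≡true⇒≢nothing _ (left t Θt)
    }
    where
    module C = Colouring C
    left : ∀ t {θ} → Θ′ t ≡ θ → horOcc C.labelling t (fromℕ N) ≡ leftBoundary θ
    left t Θt = trans (C.row-occ t (fromℕ N)) (trans (proj₁ (proj₂ (Skeleton.rows S t))) (cong leftBoundary Θt))
    right : ∀ t {θ} → Θ′ t ≡ θ → horOcc C.labelling t zero ≡ not (leftBoundary θ)
    right t Θt = trans (C.row-occ t zero) (trans (proj₂ (proj₂ (Skeleton.rows S t))) (cong (not ∘ leftBoundary) Θt))

-- Swapping two adjacent rows

transpose-matchˡ : ∀ {n} (i j : Fin n) → transpose i j i ≡ j
transpose-matchˡ i j rewrite dec-true (i F.≟ i) refl = refl

transpose-matchʳ : ∀ {n} (i j : Fin n) → transpose i j j ≡ i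
transpose-matchʳ i j with j F.≟ i
... | yes refl = refl
... | no  _ rewrite dec-true (j F.≟ j) refl = refl

transpose-other : ∀ {n} (i j k : Fin n) → k ≢ i → k ≢ j → transpose i j k ≡ k
transpose-other i j k k≢i k≢j rewrite dec-false (k F.≟ i) k≢i | dec-false (k F.≟ j) k≢j = refl

exchangeˡ : ∀ {a b x y′ y z} → a + y′ ≡ x → b + z ≡ y → y′ + y ≡ x + z → a ≡ b
exchangeˡ {a} {b} {x} {y′} {y} {z} e₁ e₂ e₃ = ℕₚ.+-cancelʳ-≡ (x + z) a b (begin
  a + (x + z)   ≡⟨ cong (a +_) (sym e₃) ⟩
  a + (y′ + y)  ≡⟨ sym (ℕₚ.+-assoc a y′ y) ⟩
  (a + y′) + y  ≡⟨ cong (_+ y) e₁ ⟩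
  x + y         ≡⟨ cong (x +_) (sym e₂) ⟩
  x + (b + z)   ≡⟨ solve (x ∷ b ∷ z ∷ []) ⟩
  b + (x + z)   ∎)
  where open ≡-Reasoning

exchangeʳ : ∀ {a b x y′ y z} → a + z ≡ y′ → b + y ≡ x → y′ + y ≡ x + z → a ≡ b
exchangeʳ {a} {b} {x} {y′} {y} {z} e₁ e₂ e₃ = ℕₚ.+-cancelʳ-≡ (y + z) a b (begin
  a + (y + z)   ≡⟨ solve (a ∷ y ∷ z ∷ []) ⟩
  (a + z) + y   ≡⟨ cong (_+ y) e₁ ⟩
  y′ + y        ≡⟨ e₃ ⟩
  x + z         ≡⟨ cong (_+ z) (sym e₂) ⟩
  (b + y) + z   ≡⟨ ℕₚ.+-assoc b y z ⟩
  b + (y + z)   ∎)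
  where open ≡-Reasoning

module Swap {m r N κ λ' Θ} (s : State m r N κ λ' Θ) (p q : Fin r)
            (adjacent : toℕ q ≡ suc (toℕ p)) (Θp≢Θq : Θ p ≢ Θ q) where

  L : Labelling m r N
  L = lab s

  Θ′ : Fin r → VType
  Θ′ = swapAt p q Θ

  E : Fin r → ℕ
  E = rowExponentOf Θ L

  suc-p≡inject₁-q : suc p ≡ inject₁ q
  suc-p≡inject₁-q = Fₚ.toℕ-injective (sym (trans (Fₚ.toℕ-inject₁ q) adjacent))

  p≢q : p ≢ q
  p≢q p≡q = ℕₚ.1+n≢n (sym (trans (cong toℕ p≡q) adjacent))

  inject₁-≢ : ∀ {t} → t ≢ q → inject₁ t ≢ inject₁ q
  inject₁-≢ t≢q = t≢q ∘ Fₚ.inject₁-injective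

  suc-≢ : ∀ {t} → t ≢ p → suc t ≢ inject₁ q
  suc-≢ t≢p e = t≢p (Fₚ.suc-injective (trans e (sym suc-p≡inject₁-q)))

  zero≢ : zero ≢ inject₁ q
  zero≢ e with trans e (sym suc-p≡inject₁-q)
  ... | ()

  suc-q≡fromℕ : ¬ suc (toℕ q) < r → suc q ≡ fromℕ r
  suc-q≡fromℕ q+1≮r =
    Fₚ.toℕ-injective (trans (ℕₚ.≤-antisym (Fₚ.toℕ<n q) (ℕₚ.≮⇒≥ q+1≮r)) (sym (Fₚ.toℕ-fromℕ r)))

  X Y Z : List ℕ
  X = cutList L (inject₁ p)
  Y = cutList L (inject₁ q)
  Z = cutList L (suc q)

  Y′ : List ℕ
  Y′ = toggle X Z Y

  toggled : InterlaceOf (Θ q) X Y′ × InterlaceOf (Θ p) Y′ Z × sum Y′ + sum Y ≡ sum X + sum Z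
  toggled = toggle-interlace (Θ p) (Θ q) Θp≢Θq X Y Z
              (subst (InterlaceOf (Θ p) X ∘ cutList L) suc-p≡inject₁-q (row-interlace s p)) (row-interlace s q)

  toggledCuts : Fin (suc r) → List ℕ
  toggledCuts = V.updateAt (cutList L) (inject₁ q) (λ _ → Y′)

  toggledCuts-q : toggledCuts (inject₁ q) ≡ Y′
  toggledCuts-q = Vₚ.updateAt-updates (inject₁ q) (cutList L)

  toggledCuts-other : ∀ k → k ≢ inject₁ q → toggledCuts k ≡ cutList L k
  toggledCuts-other k k≢ = Vₚ.updateAt-minimal k (inject₁ q) (cutList L) k≢

  toggledCuts-p : toggledCuts (inject₁ p) ≡ X
  toggledCuts-p = toggledCuts-other (inject₁ p) (inject₁-≢ p≢q)

  toggledCuts-suc-p : toggledCuts (suc p) ≡ Y′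
  toggledCuts-suc-p = trans (cong toggledCuts suc-p≡inject₁-q) toggledCuts-q

  toggledCuts-suc-q : toggledCuts (suc q) ≡ Z
  toggledCuts-suc-q = toggledCuts-other (suc q) (suc-≢ (p≢q ∘ sym))

  toggledCuts-bottom : toggledCuts (fromℕ r) ≡ []
  toggledCuts-bottom = trans (toggledCuts-other (fromℕ r) Fₚ.fromℕ≢inject₁) (cutList-bottom s)

  tPat≡toggledCuts : ∀ (k : Fin r) → tPat r (toℕ q) (ι L) (toℕ k) ≡ toggledCuts (inject₁ k)
  tPat≡toggledCuts k with k F.≟ q
  ... | yes refl = begin
    tPat r (toℕ q) (ι L) (toℕ q)             ≡⟨ tPat-row r (toℕ q) (ι L) Z (λ _ → sym (ι≡cutList L (suc q))) last ⟩
    toggle (ι L (toℕ q ∸ 1)) Z (ι L (toℕ q)) ≡⟨ cong₂ (λ U V → toggle U Z V) above (ι≡cutList-row L q) ⟩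
    Y′                                       ≡⟨ sym toggledCuts-q ⟩
    toggledCuts (inject₁ q)                  ∎
    where
    open ≡-Reasoning
    above : ι L (toℕ q ∸ 1) ≡ X
    above = trans (cong (λ i → ι L (i ∸ 1)) adjacent) (ι≡cutList-row L p)
    last : ¬ suc (toℕ q) < r → Z ≡ []
    last q+1≮r = trans (cong (cutList L) (suc-q≡fromℕ q+1≮r)) (cutList-bottom s)
  ... | no k≢q = trans (tPat-other r (toℕ q) (ι L) (toℕ k) (k≢q ∘ Fₚ.toℕ-injective))
                       (trans (ι≡cutList-row L k) (sym (toggledCuts-other (inject₁ k) (inject₁-≢ k≢q))))

  module S = Skeleton (stateSkeleton s)

  Y′-realised : Σ (Fin N → Bool) λ O → occupiedColumns N O ≡ Y′
  Y′-realised = realise N Y′ (interlace-bounded _ _ N X Y′ (proj₁ toggled) (occupiedColumns-bounded N _))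
                             (interlace-decreasing _ _ X Y′ (proj₁ toggled))

  cut′ : Fin (suc r) → Fin N → Bool
  cut′ = V.updateAt S.cut (inject₁ q) (λ _ → proj₁ Y′-realised)

  cut′-other : ∀ k → k ≢ inject₁ q → cut′ k ≡ S.cut k
  cut′-other k k≢ = Vₚ.updateAt-minimal k (inject₁ q) S.cut k≢

  cut′-columns : ∀ k → occupiedColumns N (cut′ k) ≡ toggledCuts k
  cut′-columns k with k F.≟ inject₁ q
  ... | yes refl = trans (cong (occupiedColumns N) (Vₚ.updateAt-updates k S.cut)) (trans (proj₂ Y′-realised) (sym toggledCuts-q))
  ... | no  k≢   = trans (cong (occupiedColumns N) (cut′-other k k≢)) (sym (toggledCuts-other k k≢))

  interlace′ : ∀ θ {k k′ U V} → toggledCuts k ≡ U → toggledCuts k′ ≡ V → InterlaceOf θ U V →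
               InterlaceOf θ (occupiedColumns N (cut′ k)) (occupiedColumns N (cut′ k′))
  interlace′ θ {k} {k′} U≡ V≡ =
    subst₂ (InterlaceOf θ) (sym (trans (cut′-columns k) U≡)) (sym (trans (cut′-columns k′) V≡))

  rowP : Σ (Fin (suc N) → Bool) (RowSkeleton (Θ q) N (cut′ (inject₁ p)) (cut′ (suc p)))
  rowP = interlace⇒RowSkeleton (Θ q) N (cut′ (inject₁ p)) (cut′ (suc p))
           (interlace′ (Θ q) toggledCuts-p toggledCuts-suc-p (proj₁ toggled))

  rowQ : Σ (Fin (suc N) → Bool) (RowSkeleton (Θ p) N (cut′ (inject₁ q)) (cut′ (suc q)))
  rowQ = interlace⇒RowSkeleton (Θ p) N (cut′ (inject₁ q)) (cut′ (suc q))
           (interlace′ (Θ p) toggledCuts-q toggledCuts-suc-q (proj₁ (proj₂ toggled)))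

  row′ : Fin r → Fin (suc N) → Bool
  row′ = V.updateAt (V.updateAt S.row p (λ _ → proj₁ rowP)) q (λ _ → proj₁ rowQ)

  rows′ : ∀ t → RowSkeleton (Θ′ t) N (cut′ (inject₁ t)) (cut′ (suc t)) (row′ t)
  rows′ t = by-cases t (t F.≟ p) (t F.≟ q)
    where
    by-cases : ∀ t → Dec (t ≡ p) → Dec (t ≡ q) → RowSkeleton (Θ′ t) N (cut′ (inject₁ t)) (cut′ (suc t)) (row′ t)
    by-cases t (yes refl) _ = subst₂ (λ θ H → RowSkeleton θ N (cut′ (inject₁ p)) (cut′ (suc p)) H)
      (cong Θ (sym (transpose-matchˡ p q)))
      (sym (trans (Vₚ.updateAt-minimal p q _ p≢q) (Vₚ.updateAt-updates p S.row))) (proj₂ rowP)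
    by-cases t (no _) (yes refl) = subst₂ (λ θ H → RowSkeleton θ N (cut′ (inject₁ q)) (cut′ (suc q)) H)
      (cong Θ (sym (transpose-matchʳ p q))) (sym (Vₚ.updateAt-updates q _)) (proj₂ rowQ)
    by-cases t (no t≢p) (no t≢q) = subst₂ (λ θ H → RowSkeleton θ N (cut′ (inject₁ t)) (cut′ (suc t)) H)
      (cong Θ (sym (transpose-other p q t t≢p t≢q)))
      (sym (trans (Vₚ.updateAt-minimal t q _ t≢q) (Vₚ.updateAt-minimal t p S.row t≢p)))
      (RowSkeleton-cong {HO = S.row t} (cong-app (sym (cut′-other (inject₁ t) (inject₁-≢ t≢q))))
                        (cong-app (sym (cut′-other (suc t) (suc-≢ t≢p)))) (λ _ → refl) (S.rows t))

  skeleton′ : Skeleton N Θ′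
  skeleton′ = record { cut = cut′ ; row = row′ ; rows = rows′ }

  colouring′ : Colouring skeleton′ (ver L zero)
  colouring′ = colour skeleton′ (ver L zero) (λ j → sym (cong-app (cut′-other zero zero≢) j))

  state′ : State m r N κ λ' Θ′
  state′ = record { lab = Colouring.labelling colouring′ ; isState = colouring-isState s skeleton′ colouring′ bottom-empty }
    where
    bottom-empty : ∀ j → cut′ (fromℕ r) j ≡ false
    bottom-empty j = trans (cong-app (cut′-other (fromℕ r) Fₚ.fromℕ≢inject₁) j)
                           (≡nothing⇒occupied≡false _ (IsState.botEmpty (isState s) j))

  state′-pattern : (ι (lab state′) ≈P tPat r (toℕ q) (ι L)) r
  state′-pattern k = begin
    ι (lab state′) (toℕ k)                   ≡⟨ ι≡cutList-row (lab state′) k ⟩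
    cutList (lab state′) (inject₁ k)         ≡⟨ occupiedColumns-cong N (Colouring.cut-occ colouring′ (inject₁ k)) ⟩
    occupiedColumns N (cut′ (inject₁ k))     ≡⟨ cut′-columns (inject₁ k) ⟩
    toggledCuts (inject₁ k)                  ≡⟨ sym (tPat≡toggledCuts k) ⟩
    tPat r (toℕ q) (ι L) (toℕ k)             ∎
    where open ≡-Reasoning

  module _ (s″ : State m r N κ λ' Θ′) (pattern″ : (ι (lab s″) ≈P tPat r (toℕ q) (ι L)) r) where

    E″ : Fin r → ℕ
    E″ = rowExponentOf Θ′ (lab s″)

    cuts″ : ∀ k → cutList (lab s″) k ≡ toggledCuts k
    cuts″ = cutList-determined s″ toggledCuts toggledCuts-bottom (λ k → trans (pattern″ k) (tPat≡toggledCuts k))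

    drop″ : ∀ t → E″ t + sum (toggledCuts (suc t)) ≡ sum (toggledCuts (inject₁ t))
    drop″ t = subst₂ (λ U V → E″ t + sum U ≡ sum V) (cuts″ (suc t)) (cuts″ (inject₁ t)) (rowExponent-drop s″ t)

    exponents-swapped : ∀ t → E″ t ≡ E (transpose q p t)
    exponents-swapped t = by-cases t (t F.≟ p) (t F.≟ q)
      where
      by-cases : ∀ t → Dec (t ≡ p) → Dec (t ≡ q) → E″ t ≡ E (transpose q p t)
      by-cases t (yes refl) _ =
        trans (exchangeˡ e₁ (rowExponent-drop s q) (proj₂ (proj₂ toggled))) (cong E (sym (transpose-matchʳ q p)))
        where
        e₁ : E″ p + sum Y′ ≡ sum X
        e₁ = subst₂ (λ U V → E″ p + sum U ≡ sum V) toggledCuts-suc-p toggledCuts-p (drop″ p)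
      by-cases t (no _) (yes refl) =
        trans (exchangeʳ e₁ e₂ (proj₂ (proj₂ toggled))) (cong E (sym (transpose-matchˡ q p)))
        where
        e₁ : E″ q + sum Z ≡ sum Y′
        e₁ = subst₂ (λ U V → E″ q + sum U ≡ sum V) toggledCuts-suc-q toggledCuts-q (drop″ q)
        e₂ : E p + sum Y ≡ sum X
        e₂ = subst (λ k → E p + sum (cutList L k) ≡ sum X) suc-p≡inject₁-q (rowExponent-drop s p)
      by-cases t (no t≢p) (no t≢q) =
        trans (ℕₚ.+-cancelʳ-≡ _ _ _ (trans e₁ (sym (rowExponent-drop s t)))) (cong E (sym (transpose-other q p t t≢q t≢p)))
        where
        e₁ : E″ t + sum (cutList L (suc t)) ≡ sum (cutList L (inject₁ t))
        e₁ = subst₂ (λ U V → E″ t + sum U ≡ sum V) (toggledCuts-other (suc t) (suc-≢ t≢p))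
                    (toggledCuts-other (inject₁ t) (inject₁-≢ t≢q)) (drop″ t)

    weight-swapped : ∀ {c ℓ} (R : CommutativeRing c ℓ) (z : Fin r → CommutativeRing.Carrier R) →
                     CommutativeRing._≈_ R (wt R Θ′ (lab s″) z) (wt R Θ L (swapAt p q z))
    weight-swapped R z = begin
      wt R Θ′ (lab s″) z
        ≈⟨ wt≈∏^rowExponent Θ′ (lab s″) (IsState.nonzero (isState s″)) z ⟩
      ∏.sum (λ t → z t ^ E″ t)
        ≡⟨ ∏.sum-cong-≗ (λ t → cong₂ _^_ (cong z (sym (transpose-inverse p q))) (exponents-swapped t)) ⟩
      ∏.sum (λ t → swapAt p q z (transpose q p t) ^ E (transpose q p t))
        ≈⟨ ≈-sym (∏.∑-permute (λ t → swapAt p q z t ^ E t) (Perm.transpose q p)) ⟩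
      ∏.sum (λ t → swapAt p q z t ^ E t)
        ≈⟨ ≈-sym (wt≈∏^rowExponent Θ L (IsState.nonzero (isState s)) (swapAt p q z)) ⟩
      wt R Θ L (swapAt p q z)
        ∎
      where
      open Weights R
      open CommutativeRing R using (setoid) renaming (sym to ≈-sym)
      open SemiringExp (CommutativeRing.semiring R) using (_^_)
      open import Relation.Binary.Reasoning.Setoid setoid

theorem4p7 : ∀ {c ℓ : Level} (R : CommutativeRing c ℓ)
    (m r N : ℕ) (κ : Fin r → Fin m) (λ' : Fin r → ℕ)
    → (∀ (a b : Fin r) → toℕ a ≤ toℕ b → λ' b ≤ λ' a)
    → (∀ (t : Fin r) → toℕ t ≡ 0 → λ' t + r ≤ N)
    → (Θ : Fin r → VType)
    → (p q : Fin r) → toℕ q ≡ suc (toℕ p)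
    → Θ p ≢ Θ q
    → (z : Fin r → CommutativeRing.Carrier R)
    → (𝔰 : State m r N κ λ' Θ)
    → Σ (State m r N κ λ' (swapAt p q Θ))
          (λ 𝔰' → (ι (lab 𝔰') ≈P tPat r (toℕ q) (ι (lab 𝔰))) r)
      × (∀ (𝔰' : State m r N κ λ' (swapAt p q Θ))
           → (ι (lab 𝔰') ≈P tPat r (toℕ q) (ι (lab 𝔰))) r
           → CommutativeRing._≈_ R (wt R (swapAt p q Θ) (lab 𝔰') z)
                                   (wt R Θ (lab 𝔰) (swapAt p q z)))
-- The conditions on λ' only make the lattice wide enough for states to exist.
theorem4p7 R m r N κ λ' _ _ Θ p q adjacent Θp≢Θq z 𝔰 =
  (state′ , state′-pattern) , λ 𝔰′ pattern′ → weight-swapped 𝔰′ pattern′ R z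
  where open Swap 𝔰 p q adjacent Θp≢Θq
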